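{- The characters $\chi_{\mathbf{v}}$, $\mathbf{v}\in\mathbb{F}_q^{n+d}$, are eigenvectors of $\phi_f$ as follows: the single character with $\mathbf{v}=\mathbf{0}$ has eigenvalue $q^{(d+1)n}$; the $q^{n+d}-q^n$ characters with $\mathbf{v}|_{[n+1,n+d]}\ne\mathbf{0}$ have eigenvalue $q^{dn}$; the $q^n-1$ characters with $\mathbf{v}\ne\mathbf{0}$ and $\mathbf{v}|_{[n+1,n+d]}=\mathbf{0}$ have eigenvalue $0$.
   Context: $q=p^m$ is a prime power, $n,d$ positive integers. $\mathrm{Tr}:\mathbb{F}_q\to\mathbb{F}_p$ is the trace, $e(x)=e^{2\pi i x/p}$, $\chi_{\mathbf{v}}=\sum_{\mathbf{u}\in\mathbb{F}_q^{n+d}}e(\mathrm{Tr}(\langle\mathbf{v},\mathbf{u}\rangle))x_{\mathbf{u}}\in\mathbb{C}[\mathbb{F}_q^{n+d}]$. The group algebra has product $(\sum c_{\mathbf{u}}x_{\mathbf{u}})(\sum\tilde c_{\mathbf{u}}x_{\mathbf{u}})=\sum_{\mathbf{u}}(\sum_{\tilde{\mathbf{u}}}c_{\mathbf{u}-\tilde{\mathbf{u}}}\tilde c_{\tilde{\mathbf{u}}})x_{\mathbf{u}}$; $\phi_z(g)=z\cdot g$. Here $f=\sum_{\mathbf{u}}c_{\mathbf{u}}x_{\mathbf{u}}$ with $c_{\mathbf{u}}=q^{dn}$ if $\mathbf{u}=\mathbf{0}$, $q^{d(n-1)}$ if $\mathbf{u}|_{[n]}\ne\mathbf{0}$, and $0$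 otherwise. $\mathbf{v}|_{[n]}$, $\mathbf{v}|_{[n+1,n+d]}$ are the first $n$ and last $d$ coordinates. -}

module Defs where

open import Level using (Level; _⊔_)
open import Data.Nat as ℕ using (ℕ; zero; suc)
open import Data.Fin using (Fin)
open import Data.List using (List; []; _∷_; [_]; map; concatMap; length; filter; foldr; upTo)
open import Data.List.Relation.Unary.Unique.Propositional using (Unique)
open import Data.List.Membership.Propositional using (_∈_)
open import Data.Vec as Vec using (Vec; []; _∷_; zipWith; replicate; take; drop)
open import Data.Product using (∃; _×_; _,_)
open import Data.Bool using (if_then_else_)
open import Relation.Nullary using (¬_; Dec; yes; no; ⌊_⌋)
open import Relation.Nullary.Decidable using (_×-dec_; ¬?)
open import Relation.Binary.PropositionalEquality using (_≡_; _≢_)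
open import Relation.Binary.Definitions using (DecidableEquality)
open import Algebra.Core using (Op₁; Op₂)
open import Algebra.Structures using (IsCommutativeRing)
open import Algebra.Bundles using (CommutativeRing)

record FiniteField : Set₁ where
  infixl 6 _+_
  infixl 7 _*_
  field
    Carrier  : Set
    _+_ _*_  : Op₂ Carrier
    -_       : Op₁ Carrier
    0# 1#    : Carrier
    isCommutativeRing : IsCommutativeRing _≡_ _+_ _*_ -_ 0# 1#
    _≟_      : DecidableEquality Carrier
    0≢1      : 0# ≢ 1#
    inverse  : ∀ x → x ≢ 0# → ∃ λ y → x * y ≡ 1#
    elems          : List Carrier
    elems-unique   : Unique elems
    elems-complete : ∀ x → x ∈ elems

  size : ℕ
  size = length elems

module RingUtil {c ℓ : Level} (R : CommutativeRing c ℓ) where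
  open CommutativeRing R

  fromℕ : ℕ → Carrier
  fromℕ zero    = 0#
  fromℕ (suc n) = 1# + fromℕ n

  pow : Carrier → ℕ → Carrier
  pow x zero    = 1#
  pow x (suc k) = x * pow x k

  ΣL : {A : Set} → List A → (A → Carrier) → Carrier
  ΣL xs g = foldr (λ a s → g a + s) 0# xs

  RootOfUnityData : ℕ → Carrier → Set ℓ
  RootOfUnityData p ζ = (pow ζ p ≈ 1#) × (ΣL (upTo p) (pow ζ) ≈ 0#)

-- The setting of the theorem.
-- F = 𝔽_q (q = p^m), R plays the role of ℂ, ζ the role of e^{2πi/p}.

module Setting {c ℓ : Level} (F : FiniteField) (p m : ℕ)
               (R : CommutativeRing c ℓ) (ζ : CommutativeRing.Carrier R) where
  module F = FiniteField F
  module R = CommutativeRing R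
  open RingUtil R

  q : ℕ
  q = F.size

  natF : ℕ → F.Carrier
  natF zero    = F.0#
  natF (suc k) = F._+_ F.1# (natF k)

  powF : F.Carrier → ℕ → F.Carrier
  powF x zero    = F.1#
  powF x (suc k) = F._*_ x (powF x k)

  Tr : F.Carrier → F.Carrier
  Tr x = foldr (λ i s → F._+_ (powF x (p ℕ.^ i)) s) F.0# (upTo m)

  -- e(k) = ζ^k for k ∈ 𝔽_p ≅ ℤ/p (identified via k ↦ k·1, k < p)
  eF : F.Carrier → R.Carrier
  eF t = ΣL (upTo p) (λ k → if ⌊ t F.≟ natF k ⌋ then pow ζ k else R.0#)

  Vecs : ℕ → Set
  Vecs k = Vec F.Carrier k

  allVecs : (k : ℕ) → List (Vecs k)
  allVecs zero    = [ [] ]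
  allVecs (suc k) = concatMap (λ x → map (x ∷_) (allVecs k)) F.elems

  zeroV : (k : ℕ) → Vecs k
  zeroV k = replicate k F.0#

  _≟V_ : ∀ {k} → DecidableEquality (Vecs k)
  [] ≟V [] = yes Relation.Binary.PropositionalEquality.refl
  (x ∷ xs) ≟V (y ∷ ys) with x F.≟ y | xs ≟V ys
  ... | yes Relation.Binary.PropositionalEquality.refl | yes Relation.Binary.PropositionalEquality.refl = yes Relation.Binary.PropositionalEquality.refl
  ... | no x≢y | _ = no λ { Relation.Binary.PropositionalEquality.refl → x≢y Relation.Binary.PropositionalEquality.refl }
  ... | yes _ | no xs≢ys = no λ { Relation.Binary.PropositionalEquality.refl → xs≢ys Relation.Binary.PropositionalEquality.refl }

  _-V_ : ∀ {k} → Vecs k → Vecs k → Vecs k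
  u -V w = zipWith (λ a b → F._+_ a (F.-_ b)) u w

  ⟨_,_⟩ : ∀ {k} → Vecs k → Vecs k → F.Carrier
  ⟨ v , u ⟩ = Vec.foldr _ F._+_ F.0# (zipWith F._*_ v u)

  -- the group algebra ℂ[𝔽_q^k]: Σ_u c_u x_u is represented by u ↦ c_u
  GA : ℕ → Set c
  GA k = Vecs k → R.Carrier

  _·GA_ : ∀ {k} → GA k → GA k → GA k
  _·GA_ {k} a b u = ΣL (allVecs k) (λ w → R._*_ (a (u -V w)) (b w))

  χ : ∀ {k} → Vecs k → GA k
  χ v u = eF (Tr ⟨ v , u ⟩)

  module _ (n d : ℕ) where
    head : Vecs (n ℕ.+ d) → Vecs n
    head v = take n v

    tail : Vecs (n ℕ.+ d) → Vecs d
    tail v = drop n v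

    f : GA (n ℕ.+ d)
    f u with u ≟V zeroV (n ℕ.+ d) | head u ≟V zeroV n
    ... | yes _ | _     = fromℕ (q ℕ.^ (d ℕ.* n))
    ... | no _  | no _  = fromℕ (q ℕ.^ (d ℕ.* (n ℕ.∸ 1)))
    ... | no _  | yes _ = R.0#

    φf : GA (n ℕ.+ d) → GA (n ℕ.+ d)
    φf g = f ·GA g

    IsEigenvector : GA (n ℕ.+ d) → ℕ → Set ℓ
    IsEigenvector g λ′ =
      (¬ (∀ u → g u R.≈ R.0#)) ×
      (∀ u → φf g u R.≈ R._*_ (fromℕ λ′) (g u))

    class₁? : (v : Vecs (n ℕ.+ d)) → Dec (v ≡ zeroV (n ℕ.+ d))
    class₁? v = v ≟V zeroV (n ℕ.+ d)

    class₂? : (v : Vecs (n ℕ.+ d)) → Dec (tail v ≢ zeroV d)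
    class₂? v = ¬? (tail v ≟V zeroV d)

    class₃? : (v : Vecs (n ℕ.+ d)) → Dec ((v ≢ zeroV (n ℕ.+ d)) × (tail v ≡ zeroV d))
    class₃? v = ¬? (v ≟V zeroV (n ℕ.+ d)) ×-dec (tail v ≟V zeroV d)

    count : (P : Vecs (n ℕ.+ d) → Set) → ((v : _) → Dec (P v)) → ℕ
    count P P? = length (filter P? (allVecs (n ℕ.+ d)))

{-# OPTIONS --safe #-}
-- The characters χ_v diagonalise every convolution a · _ on the group algebra: substituting
-- w = u − t in (a · χ_v)(u) = Σ_w a(u − w) ψ⟨v,w⟩, where ψ = e ∘ Tr is additive, gives
-- (a · χ_v)(u) = â(v) χ_v(u) with â(v) = Σ_t a(t) ψ(−⟨v,t⟩).  For a = f, split t = h ++ s with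
-- h ∈ 𝔽_q^n, s ∈ 𝔽_q^d; the eigenvalues then follow from the orthogonality relation
-- Σ_t ψ(−⟨w,t⟩) = q^k or 0 according as w = 0 or not, and the class sizes are counted directly.
--
-- Orthogonality carries the weight.  Since q = p^m, the characteristic of 𝔽_q is p, so
-- x ↦ x^p is additive and Tr is additive; Fermat's x^q = x makes Tr(x)^p = Tr(x), and the
-- fixed points of x ↦ x^p are the p elements k·1 because X^p − X has at most p roots.  A
-- polynomial of degree < q vanishing on 𝔽_q is zero, so Tr is onto 𝔽_p.  As ζ lives in an
-- arbitrary ring, Σ_x ψ(x) = 0 is obtained by showing that Tr takes every value equally often.
module Submission where

open import Level using (0ℓ)
open import Function using (_∘_; id; _⇔_; mk⇔)
open import Data.Empty using (⊥-elim)
open import Data.Bool using (Bool; true; false; if_then_else_)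
open import Data.Sum using (inj₁; inj₂)
open import Data.Product using (∃; _×_; _,_; proj₁; proj₂)
open import Data.Nat as ℕ using (ℕ; zero; suc; _<_; _≤_; z≤n; s≤s; _!; NonZero)
import Data.Nat.Properties as ℕ
open import Data.Nat.DivMod using (_%_; _/_; m≡m%n+[m/n]*n; m/n*n≡m; m%n<n)
open import Data.Nat.Divisibility using (_∣_; divides; ∣⇒≤; ∣1⇒≡1; m∣m*n)
open import Data.Nat.Combinatorics using (_C_; nCk≡n!/k![n-k]!; k![n∸k]!∣n!; nCn≡1)
open import Data.Nat.Primality using (Prime; euclidsLemma; prime⇒nonZero; prime⇒nonTrivial)
open import Data.Nat.Coprimality using (prime⇒coprime; coprime-Bézout)
open import Data.Nat.GCD using (module Bézout)
open import Data.Fin as Fin using (inject₁; toℕ)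
import Data.Fin.Properties as Fin
open import Data.List using (List; []; _∷_; map; concatMap; foldr; length; filter; upTo; applyUpTo)
import Data.List.Properties as List
open import Data.List.Membership.Propositional using (_∈_; lose; find)
open import Data.List.Membership.Propositional.Properties
  using (∈-map⁺; ∈-map⁻; ∈-filter⁺; ∈-filter⁻; ∈-upTo⁺; ∈-upTo⁻)
open import Data.List.Membership.Propositional.Properties.WithK using (unique∧set⇒bag)
open import Data.List.Relation.Unary.Any using (here; there; any?; satisfied)
open import Data.List.Relation.Unary.All using (All; []; _∷_; all?; lookup)
import Data.List.Relation.Unary.All as All
import Data.List.Relation.Unary.All.Properties as All
open import Data.List.Relation.Unary.All.Properties.Core using (¬All⇒Any¬)
open import Data.List.Relation.Unary.AllPairs using (_∷_)
open import Data.List.Relation.Unary.Unique.Propositional using (Unique)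
import Data.List.Relation.Unary.Unique.Propositional.Properties as Unique
open import Data.List.Relation.Binary.Permutation.Propositional as ↭ using (_↭_)
open import Data.List.Relation.Binary.BagAndSetEquality using (∼bag⇒↭)
open import Data.Vec as Vec using (Vec; []; _∷_; take; drop)
import Data.Vec.Properties as Vec
open import Relation.Nullary using (¬_; Dec; yes; no; does; ⌊_⌋)
open import Relation.Nullary.Decidable using (¬?; isYes≗does; does-⇔; dec-true; dec-false)
open import Relation.Unary using (Decidable)
open import Relation.Binary.Definitions using (DecidableEquality; tri<; tri≈; tri>)
open import Relation.Binary.PropositionalEquality as ≡ using (_≡_; _≢_; subst)
open import Algebra.Bundles using (CommutativeMonoid; CommutativeSemiring; CommutativeRing)
import Algebra.Properties.CommutativeSemigroup as CommutativeSemigroupProperties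
open import Defs

prime⇒1<p : ∀ {p} → Prime p → 1 < p
prime⇒1<p pr = ℕ.nonTrivial⇒n>1 _ {{prime⇒nonTrivial pr}}

prime∤! : ∀ {p j} → Prime p → j < p → ¬ (p ∣ j !)
prime∤! {j = zero}  pr _   p∣1  = ℕ.<⇒≢ (prime⇒1<p pr) (≡.sym (∣1⇒≡1 p∣1))
prime∤! {j = suc j} pr j<p p∣j! with euclidsLemma (suc j) (j !) pr p∣j!
... | inj₁ p∣1+j = ℕ.<⇒≱ j<p (∣⇒≤ p∣1+j)
... | inj₂ p∣j!  = prime∤! pr (ℕ.<-trans (ℕ.n<1+n j) j<p) p∣j!

n∣n! : ∀ n → .{{NonZero n}} → n ∣ n !
n∣n! (suc n) = m∣m*n (n !)

prime∣C : ∀ {p k} → Prime p → 0 < k → k < p → p ∣ p C k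
prime∣C {p} {k} pr 0<k k<p with euclidsLemma (p C k) (k ! ℕ.* (p ℕ.∸ k) !) pr p∣pCk*k![p∸k]!
  where
  instance _ = k ℕ.!* (p ℕ.∸ k) !≢0
  p∣pCk*k![p∸k]! : p ∣ (p C k) ℕ.* (k ! ℕ.* (p ℕ.∸ k) !)
  p∣pCk*k![p∸k]! = ≡.subst (p ∣_) (≡.sym pCk*k![p∸k]!≡p!) (n∣n! p {{prime⇒nonZero pr}})
    where
    pCk*k![p∸k]!≡p! : (p C k) ℕ.* (k ! ℕ.* (p ℕ.∸ k) !) ≡ p !
    pCk*k![p∸k]!≡p! = ≡.trans (≡.cong (ℕ._* (k ! ℕ.* (p ℕ.∸ k) !)) (nCk≡n!/k![n-k]! (ℕ.<⇒≤ k<p)))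
                              (m/n*n≡m (k![n∸k]!∣n! (ℕ.<⇒≤ k<p)))
... | inj₁ p∣pCk = p∣pCk
... | inj₂ p∣k![p∸k]! with euclidsLemma (k !) ((p ℕ.∸ k) !) pr p∣k![p∸k]!
...   | inj₁ p∣k!     = ⊥-elim (prime∤! pr k<p p∣k!)
...   | inj₂ p∣[p∸k]! = ⊥-elim (prime∤! pr (ℕ.∸-monoʳ-< 0<k (ℕ.<⇒≤ k<p)) p∣[p∸k]!)

2+[n∸1]≤m*n : ∀ {m n} → 1 < m → 1 ≤ n → 2 ℕ.+ (n ℕ.∸ 1) ≤ m ℕ.* n
2+[n∸1]≤m*n {m} {n} 1<m 1≤n = begin
  suc (suc (n ℕ.∸ 1))   ≡⟨ ≡.cong suc (ℕ.m+[n∸m]≡n 1≤n) ⟩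
  suc n                 ≤⟨ ℕ.+-monoˡ-≤ n 1≤n ⟩
  n ℕ.+ n               ≡⟨ ≡.cong (n ℕ.+_) (ℕ.+-identityʳ n) ⟨
  2 ℕ.* n               ≤⟨ ℕ.*-monoˡ-≤ n 1<m ⟩
  m ℕ.* n               ∎
  where open ℕ.≤-Reasoning

length-filter-≢ : ∀ {A : Set} (_≟_ : DecidableEquality A) {xs : List A} {k : A} →
                  Unique xs → k ∈ xs → suc (length (filter (λ x → ¬? (x ≟ k)) xs)) ≡ length xs
length-filter-≢ _≟_ {x ∷ xs} {k} (x∉xs ∷ u) k∈ with x ≟ k | k∈
... | yes ≡.refl | _ =
  ≡.cong (suc ∘ length) (List.filter-all (λ x → ¬? (x ≟ k)) (All.map (λ k≢y y≡k → k≢y (≡.sym y≡k)) x∉xs))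
... | no x≢k | here x≡k = ⊥-elim (x≢k (≡.sym x≡k))
... | no x≢k | there k∈xs = ≡.cong suc (length-filter-≢ _≟_ u k∈xs)

⌊⌋-⇔ : ∀ {A B : Set} → A ⇔ B → (a? : Dec A) (b? : Dec B) → ⌊ a? ⌋ ≡ ⌊ b? ⌋
⌊⌋-⇔ A⇔B a? b? = ≡.trans (isYes≗does a?) (≡.trans (does-⇔ A⇔B a? b?) (≡.sym (isYes≗does b?)))

module FiniteSum {a ℓ} (M : CommutativeMonoid a ℓ) where
  open Data.List using (_++_; [_])
  open CommutativeMonoid M renaming (Carrier to C)
  open CommutativeSemigroupProperties commutativeSemigroup using (interchange; x∙yz≈y∙xz)
  open import Relation.Binary.Reasoning.Setoid setoid

  private variable
    A B : Set
    g h : A → C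

  Σ : List A → (A → C) → C
  Σ xs g = foldr (λ x s → g x ∙ s) ε xs

  Σ-cong : (xs : List A) → (∀ x → g x ≈ h x) → Σ xs g ≈ Σ xs h
  Σ-cong []       e = refl
  Σ-cong (x ∷ xs) e = ∙-cong (e x) (Σ-cong xs e)

  Σ-ε : (xs : List A) → (∀ {x} → x ∈ xs → g x ≈ ε) → Σ xs g ≈ ε
  Σ-ε []       e = refl
  Σ-ε (x ∷ xs) e = trans (∙-cong (e (here ≡.refl)) (Σ-ε xs (e ∘ there))) (identityˡ ε)

  Σ-single : {xs : List A} {k : A} → Unique xs → k ∈ xs →
             (∀ {x} → x ∈ xs → x ≢ k → g x ≈ ε) → Σ xs g ≈ g k
  Σ-single {xs = x ∷ xs} (x∉xs ∷ _) (here ≡.refl) e =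
    trans (∙-congˡ (Σ-ε xs (λ y∈xs → e (there y∈xs) (λ y≡x → lookup x∉xs y∈xs (≡.sym y≡x)))))
          (identityʳ _)
  Σ-single {xs = x ∷ xs} (x∉xs ∷ u) (there k∈xs) e =
    trans (∙-congʳ (e (here ≡.refl) (λ x≡k → lookup x∉xs k∈xs x≡k)))
          (trans (identityˡ _) (Σ-single u k∈xs (e ∘ there)))

  Σ-++ : (xs ys : List A) → Σ (xs ++ ys) g ≈ Σ xs g ∙ Σ ys g
  Σ-++ []       ys = sym (identityˡ _)
  Σ-++ (x ∷ xs) ys = trans (∙-congˡ (Σ-++ xs ys)) (sym (assoc _ _ _))

  Σ-map : (f : A → B) (xs : List A) → Σ (map f xs) g ≈ Σ xs (g ∘ f)
  Σ-map f []       = refl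
  Σ-map f (x ∷ xs) = ∙-congˡ (Σ-map f xs)

  Σ-concatMap : (f : A → List B) (xs : List A) → Σ (concatMap f xs) g ≈ Σ xs (λ x → Σ (f x) g)
  Σ-concatMap f []       = refl
  Σ-concatMap f (x ∷ xs) = trans (Σ-++ (f x) (concatMap f xs)) (∙-congˡ (Σ-concatMap f xs))

  Σ-distrib-∙ : (xs : List A) → Σ xs (λ x → g x ∙ h x) ≈ Σ xs g ∙ Σ xs h
  Σ-distrib-∙ []       = sym (identityˡ ε)
  Σ-distrib-∙ (x ∷ xs) = trans (∙-congˡ (Σ-distrib-∙ xs)) (interchange _ _ _ _)

  Σ-swap : (xs : List A) (ys : List B) (g : A → B → C) →
           Σ xs (λ x → Σ ys (g x)) ≈ Σ ys (λ y → Σ xs (λ x → g x y))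
  Σ-swap []       ys g = sym (Σ-ε ys (λ _ → refl))
  Σ-swap (x ∷ xs) ys g = trans (∙-congˡ (Σ-swap xs ys g)) (sym (Σ-distrib-∙ ys))

  Σ-↭ : {xs ys : List A} → xs ↭ ys → Σ xs g ≈ Σ ys g
  Σ-↭ ↭.refl           = refl
  Σ-↭ (↭.prep x p)     = ∙-congˡ (Σ-↭ p)
  Σ-↭ (↭.swap x y p)   = trans (x∙yz≈y∙xz _ _ _) (∙-congˡ (∙-congˡ (Σ-↭ p)))
  Σ-↭ (↭.trans p p′)   = trans (Σ-↭ p) (Σ-↭ p′)

  Σ-upTo-∷ʳ : (n : ℕ) (g : ℕ → C) → Σ (upTo (suc n)) g ≈ Σ (upTo n) g ∙ g n
  Σ-upTo-∷ʳ n g = begin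
    Σ (upTo (suc n)) g          ≡⟨ ≡.cong (λ xs → Σ xs g) (List.upTo-∷ʳ n) ⟨
    Σ (upTo n ++ [ n ]) g       ≈⟨ Σ-++ (upTo n) [ n ] ⟩
    Σ (upTo n) g ∙ (g n ∙ ε)    ≈⟨ ∙-congˡ (identityʳ (g n)) ⟩
    Σ (upTo n) g ∙ g n          ∎

  Σ-upTo-suc : (n : ℕ) (g : ℕ → C) → Σ (upTo (suc n)) g ≈ g 0 ∙ Σ (upTo n) (g ∘ suc)
  Σ-upTo-suc n g = ∙-congˡ (begin
    Σ (applyUpTo suc n) g       ≡⟨ ≡.cong (λ xs → Σ xs g) (List.map-applyUpTo id suc n) ⟨
    Σ (map suc (upTo n)) g      ≈⟨ Σ-map suc (upTo n) ⟩
    Σ (upTo n) (g ∘ suc)        ∎)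

  Σ-upTo-rotate : (n : ℕ) (g : ℕ → C) → g n ≈ g 0 → Σ (upTo n) (g ∘ suc) ≈ Σ (upTo n) g
  Σ-upTo-rotate zero    g _       = refl
  Σ-upTo-rotate (suc n) g gn≈g0 = begin
    Σ (upTo (suc n)) (g ∘ suc)      ≈⟨ Σ-upTo-∷ʳ n (g ∘ suc) ⟩
    Σ (upTo n) (g ∘ suc) ∙ g (suc n) ≈⟨ ∙-congˡ gn≈g0 ⟩
    Σ (upTo n) (g ∘ suc) ∙ g 0       ≈⟨ comm _ _ ⟩
    g 0 ∙ Σ (upTo n) (g ∘ suc)       ≈⟨ Σ-upTo-suc n g ⟨
    Σ (upTo (suc n)) g               ∎

  Σ-reindex : {xs : List A} → Unique xs → (f f⁻¹ : A → A) →
              (∀ x → f (f⁻¹ x) ≡ x) → (∀ x → f⁻¹ (f x) ≡ x) →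
              (∀ {x} → x ∈ xs → f x ∈ xs) → (∀ {x} → x ∈ xs → f⁻¹ x ∈ xs) →
              Σ xs (g ∘ f) ≈ Σ xs g
  Σ-reindex {g = g} {xs = xs} u f f⁻¹ ff⁻¹ f⁻¹f f∈ f⁻¹∈ = trans (sym (Σ-map f xs)) (Σ-↭ image↭xs)
    where
    image↭xs : map f xs ↭ xs
    image↭xs = ∼bag⇒↭ (unique∧set⇒bag (Unique.map⁺ f-injective u) u (mk⇔ to from))
      where
      f-injective : ∀ {x y} → f x ≡ f y → x ≡ y
      f-injective {x} {y} e = ≡.trans (≡.sym (f⁻¹f x)) (≡.trans (≡.cong f⁻¹ e) (f⁻¹f y))
      to : ∀ {y} → y ∈ map f xs → y ∈ xs
      to y∈ with x , x∈ , ≡.refl ← ∈-map⁻ f y∈ = f∈ x∈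
      from : ∀ {y} → y ∈ xs → y ∈ map f xs
      from {y} y∈ = subst (_∈ map f xs) (ff⁻¹ y) (∈-map⁺ f (f⁻¹∈ y∈))

  Σ-reindex-complete : {xs : List A} → Unique xs → (∀ x → x ∈ xs) → (f f⁻¹ : A → A) →
                       (∀ x → f (f⁻¹ x) ≡ x) → (∀ x → f⁻¹ (f x) ≡ x) → Σ xs (g ∘ f) ≈ Σ xs g
  Σ-reindex-complete u complete f f⁻¹ ff⁻¹ f⁻¹f =
    Σ-reindex u f f⁻¹ ff⁻¹ f⁻¹f (λ _ → complete _) (λ _ → complete _)

module SemiringSum {a ℓ} (S : CommutativeSemiring a ℓ) where
  open CommutativeSemiring S
  open FiniteSum +-commutativeMonoid public

  private variable
    A : Set

  *-distribˡ-Σ : (k : Carrier) (xs : List A) (g : A → Carrier) → k * Σ xs g ≈ Σ xs (λ x → k * g x)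
  *-distribˡ-Σ k []       g = zeroʳ k
  *-distribˡ-Σ k (x ∷ xs) g = trans (distribˡ k _ _) (+-congˡ (*-distribˡ-Σ k xs g))

  *-distribʳ-Σ : (k : Carrier) (xs : List A) (g : A → Carrier) → Σ xs g * k ≈ Σ xs (λ x → g x * k)
  *-distribʳ-Σ k xs g = trans (*-comm _ k) (trans (*-distribˡ-Σ k xs g) (Σ-cong xs (λ _ → *-comm k _)))

  Σ-product : {B : Set} (xs : List A) (ys : List B) (f : A → Carrier) (g : B → Carrier) →
              Σ xs (λ x → Σ ys (λ y → f x * g y)) ≈ Σ xs f * Σ ys g
  Σ-product xs ys f g = trans (Σ-cong xs (λ x → sym (*-distribˡ-Σ (f x) ys g))) (sym (*-distribʳ-Σ (Σ ys g) xs f))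

module CommutativeRingProperties {c ℓ} (R : CommutativeRing c ℓ) where
  open CommutativeRing R
  open RingUtil R
  open import Algebra.Properties.Semiring.Mult semiring as Mult using (×-homo-1; ×-homo-+; ×1-homo-*; ×-assoc-*; ×-congʳ)
  open import Algebra.Properties.Semiring.Exp semiring using (_^_; ^-homo-*; ^-assocʳ)
  open import Algebra.Properties.CommutativeSemiring.Exp commutativeSemiring using (^-distrib-*)
  open import Algebra.Properties.Monoid.Sum +-monoid using (sum; sum-init-last; sum-cong-≋; sum-replicate-zero)
  import Algebra.Properties.CommutativeSemiring.Binomial commutativeSemiring as Binomial
  open import Algebra.Properties.AbelianGroup +-abelianGroup using (⁻¹-anti-homo‿-; xyx⁻¹≈y; ⁻¹-∙-comm)
  open import Algebra.Properties.CommutativeSemigroup +-commutativeSemigroup using () renaming (interchange to +-interchange)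
  open import Relation.Binary.Reasoning.Setoid setoid

  fromℕ≡×1 : ∀ k → fromℕ k ≡ k Mult.× 1#
  fromℕ≡×1 zero    = ≡.refl
  fromℕ≡×1 (suc k) = ≡.cong (1# +_) (fromℕ≡×1 k)

  pow≡^ : ∀ x k → pow x k ≡ x ^ k
  pow≡^ x zero    = ≡.refl
  pow≡^ x (suc k) = ≡.cong (x *_) (pow≡^ x k)

  fromℕ-+ : ∀ a b → fromℕ (a ℕ.+ b) ≈ fromℕ a + fromℕ b
  fromℕ-+ a b rewrite fromℕ≡×1 (a ℕ.+ b) | fromℕ≡×1 a | fromℕ≡×1 b = ×-homo-+ 1# a b

  fromℕ-* : ∀ a b → fromℕ (a ℕ.* b) ≈ fromℕ a * fromℕ b
  fromℕ-* a b rewrite fromℕ≡×1 (a ℕ.* b) | fromℕ≡×1 a | fromℕ≡×1 b = ×1-homo-* a b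

  fromℕ-^ : ∀ a k → fromℕ (a ℕ.^ k) ≈ pow (fromℕ a) k
  fromℕ-^ a zero    = +-identityʳ 1#
  fromℕ-^ a (suc k) = trans (fromℕ-* a (a ℕ.^ k)) (*-congˡ (fromℕ-^ a k))

  pow-cong : ∀ {x y} → x ≈ y → ∀ k → pow x k ≈ pow y k
  pow-cong x≈y zero    = refl
  pow-cong x≈y (suc k) = *-cong x≈y (pow-cong x≈y k)

  pow-+ : ∀ x a b → pow x (a ℕ.+ b) ≈ pow x a * pow x b
  pow-+ x a b rewrite pow≡^ x (a ℕ.+ b) | pow≡^ x a | pow≡^ x b = ^-homo-* x a b

  pow-* : ∀ x a b → pow x (a ℕ.* b) ≈ pow (pow x a) b
  pow-* x a b rewrite pow≡^ x (a ℕ.* b) | pow≡^ (pow x a) b | pow≡^ x a = sym (^-assocʳ x a b)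

  pow-distrib-* : ∀ x y k → pow (x * y) k ≈ pow x k * pow y k
  pow-distrib-* x y k rewrite pow≡^ (x * y) k | pow≡^ x k | pow≡^ y k = ^-distrib-* x y k

  pow-0# : ∀ k → .{{NonZero k}} → pow 0# k ≈ 0#
  pow-0# (suc k) = zeroˡ _

  pow-1# : ∀ k → pow 1# k ≈ 1#
  pow-1# zero    = refl
  pow-1# (suc k) = trans (*-identityˡ _) (pow-1# k)

  pow-% : ∀ {x n} .{{_ : NonZero n}} → pow x n ≈ 1# → ∀ k → pow x k ≈ pow x (k % n)
  pow-% {x} {n} xⁿ≈1 k = begin
    pow x k                                     ≡⟨ ≡.cong (pow x) (m≡m%n+[m/n]*n k n) ⟩
    pow x (k % n ℕ.+ (k / n) ℕ.* n)             ≈⟨ pow-+ x (k % n) _ ⟩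
    pow x (k % n) * pow x ((k / n) ℕ.* n)       ≡⟨ ≡.cong (λ e → pow x (k % n) * pow x e) (ℕ.*-comm (k / n) n) ⟩
    pow x (k % n) * pow x (n ℕ.* (k / n))       ≈⟨ *-congˡ (pow-* x n (k / n)) ⟩
    pow x (k % n) * pow (pow x n) (k / n)       ≈⟨ *-congˡ (trans (pow-cong xⁿ≈1 (k / n)) (pow-1# (k / n))) ⟩
    pow x (k % n) * 1#                          ≈⟨ *-identityʳ _ ⟩
    pow x (k % n)                               ∎

  [x-y]+y≈x : ∀ x y → (x - y) + y ≈ x
  [x-y]+y≈x x y = trans (+-assoc x (- y) y) (trans (+-congˡ (-‿inverseˡ y)) (+-identityʳ x))

  [x+y]-y≈x : ∀ x y → (x + y) - y ≈ x
  [x+y]-y≈x x y = trans (+-assoc x y (- y)) (trans (+-congˡ (-‿inverseʳ y)) (+-identityʳ x))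

  x-[x-y]≈y : ∀ x y → x - (x - y) ≈ y
  x-[x-y]≈y x y = trans (+-congˡ (⁻¹-anti-homo‿- x y)) (trans (sym (+-assoc x y (- x))) (xyx⁻¹≈y x y))

  [w-x]+[y-z]≈[w+y]-[x+z] : ∀ w x y z → (w - x) + (y - z) ≈ (w + y) - (x + z)
  [w-x]+[y-z]≈[w+y]-[x+z] w x y z = trans (+-interchange w (- x) y (- z)) (+-congˡ (⁻¹-∙-comm x z))

  x*[y*z]≈z : ∀ {x y} → x * y ≈ 1# → ∀ z → x * (y * z) ≈ z
  x*[y*z]≈z {x} {y} xy≈1 z = trans (sym (*-assoc x y z)) (trans (*-congʳ xy≈1) (*-identityˡ z))

  open FiniteSum *-commutativeMonoid using () renaming (Σ to Π)

  Π-distrib-pow : {A : Set} (a : Carrier) (xs : List A) (g : A → Carrier) →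
                  Π xs (λ x → a * g x) ≈ pow a (length xs) * Π xs g
  Π-distrib-pow a []       g = sym (*-identityˡ 1#)
  Π-distrib-pow a (x ∷ xs) g = trans (*-congˡ (Π-distrib-pow a xs g)) (interchange a (g x) _ _)
    where open import Algebra.Properties.CommutativeSemigroup *-commutativeSemigroup using (interchange)

  ΣL-1# : {A : Set} (xs : List A) → ΣL xs (λ _ → 1#) ≡ fromℕ (length xs)
  ΣL-1# []       = ≡.refl
  ΣL-1# (x ∷ xs) = ≡.cong (1# +_) (ΣL-1# xs)

  freshmans-dream : ∀ n x y → 0 < n → (∀ j → 0 < j → j < n → fromℕ (n C j) ≈ 0#) →
                    pow (x + y) n ≈ pow x n + pow y n
  freshmans-dream (suc n) x y _ middle≈0 rewrite pow≡^ (x + y) (suc n) | pow≡^ x (suc n) | pow≡^ y (suc n) = begin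
    (x + y) ^ suc n                                            ≈⟨ Binomial.theorem (suc n) x y ⟩
    term Fin.zero + sum (term ∘ Fin.suc)                       ≈⟨ +-congˡ (sum-init-last (term ∘ Fin.suc)) ⟩
    term Fin.zero + (sum (term ∘ Fin.suc ∘ inject₁) + term (Fin.suc (Fin.fromℕ n)))
                                                               ≈⟨ +-cong first (+-cong middle last) ⟩
    y ^ suc n + (0# + x ^ suc n)                               ≈⟨ +-comm _ _ ⟩
    (0# + x ^ suc n) + y ^ suc n                               ≈⟨ +-congʳ (+-identityˡ _) ⟩
    x ^ suc n + y ^ suc n                                      ∎
    where
    term = Binomial.binomialTerm x y (suc n)
    first : term Fin.zero ≈ y ^ suc n
    first = trans (×-homo-1 _) (*-identityˡ _)
    last : term (Fin.suc (Fin.fromℕ n)) ≈ x ^ suc n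
    last rewrite Fin.toℕ-fromℕ n | nCn≡1 (suc n) | ℕ.n∸n≡0 n = trans (×-homo-1 _) (*-identityʳ _)
    middle : sum (term ∘ Fin.suc ∘ inject₁) ≈ 0#
    middle = trans (sum-cong-≋ term≈0) (sum-replicate-zero n)
      where
      term≈0 : ∀ i → term (Fin.suc (inject₁ i)) ≈ 0#
      term≈0 i = begin
        k Mult.× b           ≈⟨ ×-congʳ k (*-identityˡ b) ⟨
        k Mult.× (1# * b)    ≈⟨ ×-assoc-* k 1# b ⟨
        (k Mult.× 1#) * b    ≡⟨ ≡.cong (_* b) (fromℕ≡×1 k) ⟨
        fromℕ k * b     ≈⟨ *-congʳ (middle≈0 _ (s≤s z≤n) (s≤s j<n)) ⟩
        0# * b          ≈⟨ zeroˡ b ⟩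
        0#              ∎
        where
        k = suc n C toℕ (Fin.suc (inject₁ i))
        b = Binomial.binomial x y (suc n) (Fin.suc (inject₁ i))
        j<n : toℕ (inject₁ i) < n
        j<n = ≡.subst (_< n) (≡.sym (Fin.toℕ-inject₁ i)) (Fin.toℕ<n i)

module PrimeCharacteristic {c ℓ} (R : CommutativeRing c ℓ) {p : ℕ} (prime : Prime p)
                           (p≈0 : CommutativeRing._≈_ R (RingUtil.fromℕ R p) (CommutativeRing.0# R)) where
  open CommutativeRing R
  open RingUtil R
  open CommutativeRingProperties R
  open SemiringSum commutativeSemiring using (Σ)
  open import Algebra.Properties.Group +-group using (identityʳ-unique)
  open import Relation.Binary.Reasoning.Setoid setoid

  private instance
    p≢0 : NonZero p
    p≢0 = prime⇒nonZero prime

  fromℕ-*-≈0 : ∀ a {z} → fromℕ z ≈ 0# → fromℕ (a ℕ.* z) ≈ 0#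
  fromℕ-*-≈0 a {z} z≈0 = trans (fromℕ-* a z) (trans (*-congˡ z≈0) (zeroʳ _))

  fromℕ-%p : ∀ k → fromℕ k ≈ fromℕ (k % p)
  fromℕ-%p k = begin
    fromℕ k                                     ≡⟨ ≡.cong fromℕ (m≡m%n+[m/n]*n k p) ⟩
    fromℕ (k % p ℕ.+ (k / p) ℕ.* p)             ≈⟨ fromℕ-+ (k % p) _ ⟩
    fromℕ (k % p) + fromℕ ((k / p) ℕ.* p)       ≈⟨ +-congˡ (fromℕ-*-≈0 (k / p) p≈0) ⟩
    fromℕ (k % p) + 0#                          ≈⟨ +-identityʳ _ ⟩
    fromℕ (k % p)                               ∎

  frobenius : ∀ x y → pow (x + y) p ≈ pow x p + pow y p
  frobenius x y = freshmans-dream p x y (ℕ.<-trans ℕ.z<s (prime⇒1<p prime)) middle≈0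
    where
    middle≈0 : ∀ j → 0 < j → j < p → fromℕ (p C j) ≈ 0#
    middle≈0 j 0<j j<p with divides a pCj≡a*p ← prime∣C prime 0<j j<p =
      trans (reflexive (≡.cong fromℕ pCj≡a*p)) (fromℕ-*-≈0 a p≈0)

  pow-fromℕ-p : ∀ k → pow (fromℕ k) p ≈ fromℕ k
  pow-fromℕ-p zero    = pow-0# p
  pow-fromℕ-p (suc k) = trans (frobenius 1# (fromℕ k)) (+-cong (pow-1# p) (pow-fromℕ-p k))

  frobenius-p^ : ∀ i x y → pow (x + y) (p ℕ.^ i) ≈ pow x (p ℕ.^ i) + pow y (p ℕ.^ i)
  frobenius-p^ zero    x y = trans (*-identityʳ _) (sym (+-cong (*-identityʳ x) (*-identityʳ y)))
  frobenius-p^ (suc i) x y = begin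
    pow (x + y) (p ℕ.* p ℕ.^ i)                            ≈⟨ pow-* (x + y) p (p ℕ.^ i) ⟩
    pow (pow (x + y) p) (p ℕ.^ i)                          ≈⟨ pow-cong (frobenius x y) (p ℕ.^ i) ⟩
    pow (pow x p + pow y p) (p ℕ.^ i)                      ≈⟨ frobenius-p^ i (pow x p) (pow y p) ⟩
    pow (pow x p) (p ℕ.^ i) + pow (pow y p) (p ℕ.^ i)      ≈⟨ +-cong (pow-* x p (p ℕ.^ i)) (pow-* y p (p ℕ.^ i)) ⟨
    pow x (p ℕ.* p ℕ.^ i) + pow y (p ℕ.* p ℕ.^ i)          ∎

  pow-p^-fixed : ∀ {b} i → pow b p ≈ b → pow b (p ℕ.^ i) ≈ b
  pow-p^-fixed {b} zero    _       = *-identityʳ b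
  pow-p^-fixed {b} (suc i) b-fixed = trans (pow-* b p (p ℕ.^ i)) (trans (pow-cong b-fixed (p ℕ.^ i)) (pow-p^-fixed i b-fixed))

  frobenius-Σ : ∀ {A : Set} (xs : List A) g → pow (Σ xs g) p ≈ Σ xs (λ a → pow (g a) p)
  frobenius-Σ []       g = pow-0# p
  frobenius-Σ (a ∷ xs) g = trans (frobenius (g a) _) (+-congˡ (frobenius-Σ xs g))

  bézout⇒1≈0 : ∀ a b {z w} → fromℕ z ≈ 0# → fromℕ w ≈ 0# → 1 ℕ.+ a ℕ.* z ≡ b ℕ.* w → 1# ≈ 0#
  bézout⇒1≈0 a b {z} {w} z≈0 w≈0 1+az≡bw = begin
    1#                          ≈⟨ +-identityʳ 1# ⟨
    fromℕ 1                     ≈⟨ +-identityʳ _ ⟨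
    fromℕ 1 + 0#                ≈⟨ +-congˡ (fromℕ-*-≈0 a z≈0) ⟨
    fromℕ 1 + fromℕ (a ℕ.* z)   ≈⟨ fromℕ-+ 1 (a ℕ.* z) ⟨
    fromℕ (1 ℕ.+ a ℕ.* z)       ≡⟨ ≡.cong fromℕ 1+az≡bw ⟩
    fromℕ (b ℕ.* w)             ≈⟨ fromℕ-*-≈0 b w≈0 ⟩
    0#                          ∎

  module _ (1≉0 : ¬ (1# ≈ 0#)) where

    fromℕ≉0 : ∀ {k} → 0 < k → k < p → ¬ (fromℕ k ≈ 0#)
    fromℕ≉0 {k} 0<k k<p k≈0 with coprime-Bézout (prime⇒coprime prime {{ℕ.>-nonZero 0<k}} k<p)
    ... | Bézout.+- a b 1+bk≡ap = 1≉0 (bézout⇒1≈0 b a k≈0 p≈0 1+bk≡ap)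
    ... | Bézout.-+ a b 1+ap≡bk = 1≉0 (bézout⇒1≈0 a b p≈0 k≈0 1+ap≡bk)

    fromℕ-<⇒≉ : ∀ {i j} → i < j → j < p → ¬ (fromℕ i ≈ fromℕ j)
    fromℕ-<⇒≉ {i} {j} i<j j<p i≈j = fromℕ≉0 (ℕ.m<n⇒0<n∸m i<j) (ℕ.≤-<-trans (ℕ.m∸n≤m j i) j<p)
      (identityʳ-unique (fromℕ i) _ (begin
        fromℕ i + fromℕ (j ℕ.∸ i)    ≈⟨ fromℕ-+ i (j ℕ.∸ i) ⟨
        fromℕ (i ℕ.+ (j ℕ.∸ i))      ≡⟨ ≡.cong fromℕ (ℕ.m+[n∸m]≡n (ℕ.<⇒≤ i<j)) ⟩
        fromℕ j                      ≈⟨ i≈j ⟨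
        fromℕ i                      ∎))

    fromℕ-injective : ∀ {i j} → i < p → j < p → fromℕ i ≈ fromℕ j → i ≡ j
    fromℕ-injective {i} {j} i<p j<p i≈j with ℕ.<-cmp i j
    ... | tri< i<j _ _ = ⊥-elim (fromℕ-<⇒≉ i<j j<p i≈j)
    ... | tri≈ _ i≡j _ = i≡j
    ... | tri> _ _ j<i = ⊥-elim (fromℕ-<⇒≉ j<i i<p (sym i≈j))

module FiniteFieldProperties (F : FiniteField) where
  open FiniteField F using (_≟_; 0≢1; inverse; elems; elems-unique; elems-complete; size; isCommutativeRing)

  commutativeRing : CommutativeRing 0ℓ 0ℓ
  commutativeRing = record { isCommutativeRing = isCommutativeRing }

  open CommutativeRing commutativeRing
  open RingUtil commutativeRing
  open CommutativeRingProperties commutativeRing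
  open SemiringSum commutativeSemiring
  open import Algebra.Properties.AbelianGroup +-abelianGroup using (identityʳ-unique; xyx⁻¹≈y; x∙y⁻¹≈ε⇒x≈y)
  open import Algebra.Solver.Ring.NaturalCoefficients.Default commutativeSemiring using (solve; _:=_; _:+_; _:*_; con)
  open ≡.≡-Reasoning

  private variable
    x y z : Carrier

  *-cancelˡ : x ≢ 0# → x * y ≡ x * z → y ≡ z
  *-cancelˡ {x} {y} {z} x≢0 xy≡xz with x′ , xx′≡1 ← inverse x x≢0 =
    ≡.trans (≡.sym (x′*[x*y]≡y y)) (≡.trans (≡.cong (x′ *_) xy≡xz) (x′*[x*y]≡y z))
    where x′*[x*y]≡y = x*[y*z]≈z (≡.trans (*-comm x′ x) xx′≡1)

  x*y≡0⇒y≡0 : x ≢ 0# → x * y ≡ 0# → y ≡ 0#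
  x*y≡0⇒y≡0 {x} x≢0 xy≡0 = *-cancelˡ x≢0 (≡.trans xy≡0 (≡.sym (zeroʳ x)))

  *-≢0 : x ≢ 0# → y ≢ 0# → x * y ≢ 0#
  *-≢0 x≢0 y≢0 xy≡0 = y≢0 (x*y≡0⇒y≡0 x≢0 xy≡0)

  pow≡0⇒≡0 : ∀ k → pow x k ≡ 0# → x ≡ 0#
  pow≡0⇒≡0 zero    1≡0  = ⊥-elim (0≢1 (≡.sym 1≡0))
  pow≡0⇒≡0 {x} (suc k) xxᵏ≡0 with x ≟ 0#
  ... | yes x≡0 = x≡0
  ... | no  x≢0 = pow≡0⇒≡0 k (x*y≡0⇒y≡0 x≢0 xxᵏ≡0)

  fromℕ-size≡0 : fromℕ size ≡ 0#
  fromℕ-size≡0 = identityʳ-unique S (fromℕ size) (begin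
    S + fromℕ size
      ≡⟨ ≡.cong (S +_) (ΣL-1# elems) ⟨
    S + Σ elems (λ _ → 1#)
      ≡⟨ Σ-distrib-∙ elems ⟨
    Σ elems (λ x → x + 1#)
      ≡⟨ Σ-reindex-complete elems-unique elems-complete (_+ 1#) (_- 1#) (λ x → [x-y]+y≈x x 1#) (λ x → [x+y]-y≈x x 1#) ⟩
    S                               ∎)
    where
    S = Σ elems id

  nonzero : List Carrier
  nonzero = filter (λ x → ¬? (x ≟ 0#)) elems

  suc-length-nonzero : suc (length nonzero) ≡ size
  suc-length-nonzero = length-filter-≢ _≟_ elems-unique (elems-complete 0#)

  ∈-nonzero⁺ : x ≢ 0# → x ∈ nonzero
  ∈-nonzero⁺ {x} = ∈-filter⁺ (λ x → ¬? (x ≟ 0#)) (elems-complete x)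

  ∈-nonzero⁻ : x ∈ nonzero → x ≢ 0#
  ∈-nonzero⁻ = proj₂ ∘ ∈-filter⁻ (λ x → ¬? (x ≟ 0#)) {xs = elems}

  pow-length-nonzero : x ≢ 0# → pow x (length nonzero) ≡ 1#
  pow-length-nonzero {x} x≢0 with x′ , xx′≡1 ← inverse x x≢0 = ≡.sym (*-cancelˡ (Π-≢0 nonzero ∈-nonzero⁻) (begin
    Π nonzero id * 1#                       ≡⟨ *-identityʳ _ ⟩
    Π nonzero id                            ≡⟨ Π-reindex (Unique.filter⁺ _ elems-unique) (x *_) (x′ *_)
                                                 x[x′y]≡y x′[xy]≡y (∈-nonzero⁺ ∘ *-≢0 x≢0 ∘ ∈-nonzero⁻)
                                                 (∈-nonzero⁺ ∘ *-≢0 x′≢0 ∘ ∈-nonzero⁻) ⟨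
    Π nonzero (x *_)                        ≡⟨ Π-distrib-pow x nonzero id ⟩
    pow x (length nonzero) * Π nonzero id   ≡⟨ *-comm _ _ ⟩
    Π nonzero id * pow x (length nonzero)   ∎))
    where
    open FiniteSum *-commutativeMonoid using () renaming (Σ to Π; Σ-reindex to Π-reindex)
    Π-≢0 : ∀ xs → (∀ {x} → x ∈ xs → x ≢ 0#) → Π xs id ≢ 0#
    Π-≢0 []       _    1≡0 = 0≢1 (≡.sym 1≡0)
    Π-≢0 (x ∷ xs) all≢0    = *-≢0 (all≢0 (here ≡.refl)) (Π-≢0 xs (all≢0 ∘ there))
    x′x≡1 : x′ * x ≡ 1#
    x′x≡1 = ≡.trans (*-comm x′ x) xx′≡1
    x′≢0 : x′ ≢ 0#
    x′≢0 x′≡0 = 0≢1 (≡.trans (≡.sym (zeroˡ x)) (≡.trans (≡.cong (_* x) (≡.sym x′≡0)) x′x≡1))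
    x[x′y]≡y = x*[y*z]≈z xx′≡1
    x′[xy]≡y = x*[y*z]≈z x′x≡1

  pow-size : ∀ x → pow x size ≡ x
  pow-size x with x ≟ 0#
  ... | yes ≡.refl = ≡.subst (λ k → pow 0# k ≡ 0#) suc-length-nonzero (zeroˡ _)
  ... | no  x≢0    = ≡.subst (λ k → pow x k ≡ x) suc-length-nonzero
                       (≡.trans (≡.cong (x *_) (pow-length-nonzero x≢0)) (*-identityʳ x))

  eval : List Carrier → Carrier → Carrier
  eval []       x = 0#
  eval (c ∷ cs) x = c + x * eval cs x

  quotient : Carrier → List Carrier → List Carrier
  quotient a []           = []
  quotient a (c ∷ [])     = []
  quotient a (c ∷ d ∷ cs) = eval (d ∷ cs) a ∷ quotient a (d ∷ cs)

  length-quotient : ∀ a c cs → length (quotient a (c ∷ cs)) ≡ length cs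
  length-quotient a c []       = ≡.refl
  length-quotient a c (d ∷ cs) = ≡.cong suc (length-quotient a d cs)

  -- Synthetic division by X − a, evaluated at a + y so that no subtraction occurs (a semiring identity).
  eval-quotient : ∀ cs a y → eval cs (a + y) ≡ eval cs a + y * eval (quotient a cs) (a + y)
  eval-quotient []           a y = solve 1 (λ y → con 0 := con 0 :+ y :* con 0) ≡.refl y
  eval-quotient (c ∷ [])     a y = solve 3 (λ c a y → c :+ (a :+ y) :* con 0 := (c :+ a :* con 0) :+ y :* con 0) ≡.refl c a y
  eval-quotient (c ∷ d ∷ cs) a y = begin
    c + (a + y) * eval (d ∷ cs) (a + y)
      ≡⟨ ≡.cong (λ e → c + (a + y) * e) (eval-quotient (d ∷ cs) a y) ⟩
    c + (a + y) * (E + y * Q)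
      ≡⟨ solve 5 (λ c a y E Q → c :+ (a :+ y) :* (E :+ y :* Q) := (c :+ a :* E) :+ y :* (E :+ (a :+ y) :* Q)) ≡.refl c a y E Q ⟩
    (c + a * E) + y * (E + (a + y) * Q)  ∎
    where
    E = eval (d ∷ cs) a
    Q = eval (quotient a (d ∷ cs)) (a + y)

  root-quotient : ∀ {cs a b} → eval cs a ≡ 0# → eval cs b ≡ 0# → b ≢ a → eval (quotient a cs) b ≡ 0#
  root-quotient {cs} {a} {b} a-root b-root b≢a = x*y≡0⇒y≡0 b-a≢0 (begin
    (b - a) * eval (quotient a cs) b
      ≡⟨ +-identityˡ _ ⟨
    0# + (b - a) * eval (quotient a cs) b
      ≡⟨ ≡.cong₂ (λ e x → e + (b - a) * eval (quotient a cs) x) a-root a+[b-a]≡b ⟨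
    eval cs a + (b - a) * eval (quotient a cs) (a + (b - a))
      ≡⟨ eval-quotient cs a (b - a) ⟨
    eval cs (a + (b - a))
      ≡⟨ ≡.cong (eval cs) a+[b-a]≡b ⟩
    eval cs b
      ≡⟨ b-root ⟩
    0#                                                ∎)
    where
    a+[b-a]≡b : a + (b - a) ≡ b
    a+[b-a]≡b = ≡.trans (≡.sym (+-assoc a b (- a))) (xyx⁻¹≈y a b)
    b-a≢0 : b - a ≢ 0#
    b-a≢0 = b≢a ∘ x∙y⁻¹≈ε⇒x≈y b a

  quotient-zero⇒zero : ∀ cs {a} → eval cs a ≡ 0# → All (_≡ 0#) (quotient a cs) → All (_≡ 0#) cs
  quotient-zero⇒zero []           _      _                = []
  quotient-zero⇒zero (c ∷ [])     {a} c-root _          = ≡.trans (solve 2 (λ c a → c := c :+ a :* con 0) ≡.refl c a) c-root ∷ []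
  quotient-zero⇒zero (c ∷ d ∷ cs) {a} a-root (E≡0 ∷ q≡0) = c≡0 ∷ quotient-zero⇒zero (d ∷ cs) E≡0 q≡0
    where
    c≡0 : c ≡ 0#
    c≡0 = begin
      c                           ≡⟨ solve 2 (λ c a → c := c :+ a :* con 0) ≡.refl c a ⟩
      c + a * 0#                  ≡⟨ ≡.cong (λ e → c + a * e) E≡0 ⟨
      c + a * eval (d ∷ cs) a     ≡⟨ a-root ⟩
      0#                          ∎

  roots⇒zero : ∀ cs {xs} → Unique xs → All (λ x → eval cs x ≡ 0#) xs → length cs ≤ length xs → All (_≡ 0#) cs
  roots⇒zero []       _            _                 _         = []
  roots⇒zero (c ∷ cs) {a ∷ xs} (a∉xs ∷ u) (a-root ∷ roots) (s≤s cs≤xs) =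
    quotient-zero⇒zero (c ∷ cs) a-root (roots⇒zero (quotient a (c ∷ cs)) u
      (All.zipWith (λ (a≢x , x-root) → root-quotient {c ∷ cs} a-root x-root (a≢x ∘ ≡.sym)) (a∉xs , roots))
      (≡.subst (_≤ length xs) (≡.sym (length-quotient a c cs)) cs≤xs))

  monomial : ℕ → List Carrier
  monomial zero    = 1# ∷ []
  monomial (suc k) = 0# ∷ monomial k

  eval-monomial : ∀ k x → eval (monomial k) x ≡ pow x k
  eval-monomial zero    x = ≡.trans (≡.cong (1# +_) (zeroʳ x)) (+-identityʳ 1#)
  eval-monomial (suc k) x = ≡.trans (+-identityˡ _) (≡.cong (x *_) (eval-monomial k x))

  length-monomial : ∀ k → length (monomial k) ≡ suc k
  length-monomial zero    = ≡.refl
  length-monomial (suc k) = ≡.cong suc (length-monomial k)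

  infixl 6 _⊕_
  _⊕_ : List Carrier → List Carrier → List Carrier
  []       ⊕ ds       = ds
  (c ∷ cs) ⊕ []       = c ∷ cs
  (c ∷ cs) ⊕ (d ∷ ds) = c + d ∷ cs ⊕ ds

  eval-⊕ : ∀ cs ds x → eval (cs ⊕ ds) x ≡ eval cs x + eval ds x
  eval-⊕ []       ds       x = ≡.sym (+-identityˡ _)
  eval-⊕ (c ∷ cs) []       x = ≡.sym (+-identityʳ _)
  eval-⊕ (c ∷ cs) (d ∷ ds) x = ≡.trans (≡.cong (λ e → c + d + x * e) (eval-⊕ cs ds x))
    (solve 5 (λ c d x E D → c :+ d :+ x :* (E :+ D) := (c :+ x :* E) :+ (d :+ x :* D)) ≡.refl c d x (eval cs x) (eval ds x))

  length-⊕ : ∀ cs ds {n} → length cs ≤ n → length ds ≤ n → length (cs ⊕ ds) ≤ n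
  length-⊕ []       ds       _         ds≤n      = ds≤n
  length-⊕ (c ∷ cs) []       cs≤n      _         = cs≤n
  length-⊕ (c ∷ cs) (d ∷ ds) (s≤s cs≤n) (s≤s ds≤n) = s≤s (length-⊕ cs ds cs≤n ds≤n)

  monomials : List ℕ → List Carrier
  monomials []       = []
  monomials (e ∷ es) = monomial e ⊕ monomials es

  eval-monomials : ∀ es x → eval (monomials es) x ≡ Σ es (pow x)
  eval-monomials []       x = ≡.refl
  eval-monomials (e ∷ es) x = ≡.trans (eval-⊕ (monomial e) (monomials es) x)
                                      (≡.cong₂ _+_ (eval-monomial e x) (eval-monomials es x))

  length-monomials : ∀ {n} es → All (λ e → suc e ≤ n) es → length (monomials es) ≤ n
  length-monomials []       []            = z≤n
  length-monomials (e ∷ es) (e<n ∷ es<n) =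
    length-⊕ (monomial e) (monomials es) (≡.subst (_≤ _) (≡.sym (length-monomial e)) e<n) (length-monomials es es<n)

  1<size : 1 < size
  1<size = ≡.subst (1 <_) suc-length-nonzero (s≤s (nonempty (∈-nonzero⁺ (0≢1 ∘ ≡.sym))))
    where
    nonempty : ∀ {x : Carrier} {xs} → x ∈ xs → 0 < length xs
    nonempty (here _)  = s≤s z≤n
    nonempty (there _) = s≤s z≤n

module PrimePowerField (F : FiniteField) {p m : ℕ} (prime : Prime p) (size≡p^m : FiniteField.size F ≡ p ℕ.^ m) where
  open FiniteField F using (_≟_; 0≢1; inverse; elems; elems-unique; size)
  open FiniteFieldProperties F
  open CommutativeRing commutativeRing
  open RingUtil commutativeRing
  open CommutativeRingProperties commutativeRing
  open SemiringSum commutativeSemiring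
  open import Algebra.Properties.Ring ring using (-‿distribʳ-*)
  open ≡.≡-Reasoning
  open import Algebra.Solver.Ring.NaturalCoefficients.Default commutativeSemiring using (solve; _:=_; _:+_; _:*_; con)

  private instance
    p≢0 : ℕ.NonZero p
    p≢0 = prime⇒nonZero prime

  fromℕ-p≡0 : fromℕ p ≡ 0#
  fromℕ-p≡0 = pow≡0⇒≡0 m (begin
    pow (fromℕ p) m    ≡⟨ fromℕ-^ p m ⟨
    fromℕ (p ℕ.^ m)    ≡⟨ ≡.cong fromℕ size≡p^m ⟨
    fromℕ size         ≡⟨ fromℕ-size≡0 ⟩
    0#                 ∎)

  open PrimeCharacteristic commutativeRing prime fromℕ-p≡0 public

  1<p : 1 < p
  1<p = prime⇒1<p prime

  -1≢0 : - 1# ≢ 0#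
  -1≢0 -1≡0 = 0≢1 (≡.sym (begin
    1#             ≡⟨ +-identityʳ 1# ⟨
    1# + 0#        ≡⟨ ≡.cong (1# +_) -1≡0 ⟨
    1# + - 1#      ≡⟨ -‿inverseʳ 1# ⟩
    0#             ∎))

  frobenius-fixed⇒fromℕ : ∀ y → pow y p ≡ y → ∃ λ k → k < p × y ≡ fromℕ k
  frobenius-fixed⇒fromℕ y y-fixed with any? (λ k → y ≟ fromℕ k) (upTo p)
  ... | yes y∈𝔽p = let k , k∈ , y≡k = find y∈𝔽p in k , ∈-upTo⁻ k∈ , y≡k
  -- Otherwise X^p − X would have the p + 1 distinct roots y, 0·1, …, (p − 1)·1.
  ... | no  y∉𝔽p =
    ⊥-elim (-1≢0 (coefficient-1≡0 (roots⇒zero xᵖ-x (y∉ ∷ fromℕ-unique) (root y y-fixed ∷ fromℕ-roots) length≤)))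
    where
    xᵖ-x : List Carrier
    xᵖ-x = 0# ∷ - 1# ∷ monomial (p ℕ.∸ 2)
    root : ∀ x → pow x p ≡ x → eval xᵖ-x x ≡ 0#
    root x x-fixed = begin
      0# + x * (- 1# + x * eval (monomial (p ℕ.∸ 2)) x)
        ≡⟨ +-identityˡ _ ⟩
      x * (- 1# + x * eval (monomial (p ℕ.∸ 2)) x)
        ≡⟨ distribˡ x (- 1#) _ ⟩
      x * - 1# + x * (x * eval (monomial (p ℕ.∸ 2)) x)
        ≡⟨ ≡.cong₂ _+_ (≡.trans (≡.sym (-‿distribʳ-* x 1#)) (≡.cong -_ (*-identityʳ x))) xxxᵖ⁻²≡x ⟩
      - x + x
        ≡⟨ -‿inverseˡ x ⟩
      0#                                                  ∎
      where
      xxxᵖ⁻²≡x : x * (x * eval (monomial (p ℕ.∸ 2)) x) ≡ x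
      xxxᵖ⁻²≡x = ≡.trans (≡.cong (λ e → x * (x * e)) (eval-monomial (p ℕ.∸ 2) x))
                         (≡.trans (≡.cong (pow x) (ℕ.m+[n∸m]≡n {2} 1<p)) x-fixed)
    fromℕ-unique = Unique.applyUpTo⁺₁ fromℕ p
      (λ i<j j<p → ℕ.<⇒≢ i<j ∘ fromℕ-injective (0≢1 ∘ ≡.sym) (ℕ.<-trans i<j j<p) j<p)
    y∉ = All.applyUpTo⁺₁ fromℕ p (λ k<p y≡k → y∉𝔽p (lose (∈-upTo⁺ k<p) y≡k))
    fromℕ-roots = All.applyUpTo⁺₁ fromℕ p (λ {k} _ → root (fromℕ k) (pow-fromℕ-p k))
    length≤ : length xᵖ-x ≤ length (y ∷ applyUpTo fromℕ p)
    length≤ = ℕ.≤-reflexive (begin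
      suc (suc (length (monomial (p ℕ.∸ 2))))    ≡⟨ ≡.cong (suc ∘ suc) (length-monomial (p ℕ.∸ 2)) ⟩
      suc (suc (suc (p ℕ.∸ 2)))                  ≡⟨ ≡.cong suc (ℕ.m+[n∸m]≡n {2} 1<p) ⟩
      suc p                                      ≡⟨ ≡.cong suc (List.length-applyUpTo fromℕ p) ⟨
      length (y ∷ applyUpTo fromℕ p)             ∎)
    coefficient-1≡0 : All (_≡ 0#) xᵖ-x → - 1# ≡ 0#
    coefficient-1≡0 (_ ∷ -1≡0 ∷ _) = -1≡0

  -- Tr of Defs, restated with RingUtil.pow so that it depends on F alone (Tr≡trace below).
  trace : Carrier → Carrier
  trace x = Σ (upTo m) (λ i → pow x (p ℕ.^ i))

  trace-+ : ∀ x y → trace (x + y) ≡ trace x + trace y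
  trace-+ x y = ≡.trans (Σ-cong (upTo m) (λ i → frobenius-p^ i x y)) (Σ-distrib-∙ (upTo m))

  trace-*-fixed : ∀ {b} x → pow b p ≡ b → trace (b * x) ≡ b * trace x
  trace-*-fixed {b} x b-fixed = begin
    Σ (upTo m) (λ i → pow (b * x) (p ℕ.^ i))              ≡⟨ Σ-cong (upTo m) (λ i → pow-distrib-* b x (p ℕ.^ i)) ⟩
    Σ (upTo m) (λ i → pow b (p ℕ.^ i) * pow x (p ℕ.^ i))  ≡⟨ Σ-cong (upTo m) (λ i → ≡.cong (_* _) (pow-p^-fixed i b-fixed)) ⟩
    Σ (upTo m) (λ i → b * pow x (p ℕ.^ i))                ≡⟨ *-distribˡ-Σ b (upTo m) _ ⟨
    b * trace x                                           ∎

  trace-fixed : ∀ x → pow (trace x) p ≡ trace x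
  trace-fixed x = begin
    pow (trace x) p
      ≡⟨ frobenius-Σ (upTo m) _ ⟩
    Σ (upTo m) (λ i → pow (pow x (p ℕ.^ i)) p)
      ≡⟨ Σ-cong (upTo m) (λ i → ≡.trans (≡.cong (pow x) (ℕ.*-comm p (p ℕ.^ i))) (pow-* x (p ℕ.^ i) p)) ⟨
    Σ (upTo m) (λ i → pow x (p ℕ.^ suc i))
      ≡⟨ Σ-upTo-rotate m (λ i → pow x (p ℕ.^ i)) xᵖ^ᵐ≡x¹ ⟩
    trace x                                            ∎
    where
    xᵖ^ᵐ≡x¹ : pow x (p ℕ.^ m) ≡ pow x 1
    xᵖ^ᵐ≡x¹ = ≡.trans (≡.cong (pow x) (≡.sym size≡p^m)) (≡.trans (pow-size x) (≡.sym (*-identityʳ x)))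

  trace∈𝔽p : ∀ x → ∃ λ k → k < p × trace x ≡ fromℕ k
  trace∈𝔽p x = frobenius-fixed⇒fromℕ (trace x) (trace-fixed x)

  0<m : 0 < m
  0<m = ℕ.n≢0⇒n>0 (λ m≡0 → ℕ.<-irrefl ≡.refl (≡.subst (1 <_) (≡.trans size≡p^m (≡.cong (p ℕ.^_) m≡0)) 1<size))

  private
    m′ = ℕ.pred m
    1+m′≡m : suc m′ ≡ m
    1+m′≡m = ℕ.suc-pred m {{ℕ.>-nonZero 0<m}}

  2≤p^[1+i] : ∀ i → 2 ≤ p ℕ.^ suc i
  2≤p^[1+i] i = ℕ.≤-trans 1<p (ℕ.≤-trans (ℕ.≤-reflexive (≡.sym (ℕ.*-identityʳ p))) (ℕ.^-monoʳ-≤ p (s≤s (z≤n {i}))))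

  -- trace x = x + x · x · Σ_{0<i<m} x^(p^i − 2): the coefficient of x is 1 and the degree is p^(m−1) < q.
  trace-polynomial : List Carrier
  trace-polynomial = 0# ∷ 1# ∷ monomials (map (λ i → p ℕ.^ suc i ℕ.∸ 2) (upTo m′))

  eval-trace-polynomial : ∀ x → eval trace-polynomial x ≡ trace x
  eval-trace-polynomial x = begin
    0# + x * (1# + x * eval (monomials (map e (upTo m′))) x)
      ≡⟨ ≡.cong (λ s → 0# + x * (1# + x * s)) (eval-monomials (map e (upTo m′)) x) ⟩
    0# + x * (1# + x * Σ (map e (upTo m′)) (pow x))
      ≡⟨ solve 2 (λ x s → con 0 :+ x :* (con 1 :+ x :* s) := x :* con 1 :+ x :* (x :* s)) ≡.refl x _ ⟩
    pow x 1 + x * (x * Σ (map e (upTo m′)) (pow x))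
      ≡⟨ ≡.cong (λ s → pow x 1 + x * (x * s)) (Σ-map e (upTo m′)) ⟩
    pow x 1 + x * (x * Σ (upTo m′) (pow x ∘ e))
      ≡⟨ ≡.cong (pow x 1 +_) x[xΣ]≡Σ ⟩
    pow x 1 + Σ (upTo m′) (λ i → pow x (p ℕ.^ suc i))
      ≡⟨ Σ-upTo-suc m′ (λ i → pow x (p ℕ.^ i)) ⟨
    Σ (upTo (suc m′)) (λ i → pow x (p ℕ.^ i))
      ≡⟨ ≡.cong (λ k → Σ (upTo k) (λ i → pow x (p ℕ.^ i))) 1+m′≡m ⟩
    trace x                                                     ∎
    where
    e = λ i → p ℕ.^ suc i ℕ.∸ 2
    x[xΣ]≡Σ : x * (x * Σ (upTo m′) (pow x ∘ e)) ≡ Σ (upTo m′) (λ i → pow x (p ℕ.^ suc i))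
    x[xΣ]≡Σ = begin
      x * (x * Σ (upTo m′) (pow x ∘ e))          ≡⟨ ≡.cong (x *_) (*-distribˡ-Σ x (upTo m′) _) ⟩
      x * Σ (upTo m′) (λ i → x * pow x (e i))    ≡⟨ *-distribˡ-Σ x (upTo m′) _ ⟩
      Σ (upTo m′) (λ i → x * (x * pow x (e i)))  ≡⟨ Σ-cong (upTo m′) (λ i → ≡.cong (pow x) (ℕ.m+[n∸m]≡n (2≤p^[1+i] i))) ⟩
      Σ (upTo m′) (λ i → pow x (p ℕ.^ suc i))    ∎

  length-trace-polynomial : length trace-polynomial ≤ size
  length-trace-polynomial =
    ℕ.≤-trans (s≤s (s≤s (length-monomials _ (All.map⁺ (All.applyUpTo⁺₁ id m′ e<)))))
    (ℕ.≤-trans (2+[n∸1]≤m*n 1<p (ℕ.m^n>0 p m′))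
               (ℕ.≤-reflexive (≡.trans (≡.cong (p ℕ.^_) 1+m′≡m) (≡.sym size≡p^m))))
    where
    e = λ i → p ℕ.^ suc i ℕ.∸ 2
    e< : ∀ {i} → i < m′ → suc (e i) ≤ p ℕ.^ m′ ℕ.∸ 1
    e< {i} i<m′ = ℕ.≤-trans (ℕ.≤-reflexive (≡.sym (ℕ.+-∸-assoc 1 (2≤p^[1+i] i))))
                            (ℕ.∸-monoˡ-≤ 1 (ℕ.^-monoʳ-≤ p i<m′))

  trace-nonzero : ∃ λ a → trace a ≢ 0#
  trace-nonzero with all? (λ a → trace a ≟ 0#) elems
  ... | no  ¬all≡0 = satisfied (¬All⇒Any¬ (λ a → trace a ≟ 0#) elems ¬all≡0)
  ... | yes all≡0  = ⊥-elim (0≢1 (≡.sym (coefficient-1≡0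
      (roots⇒zero trace-polynomial elems-unique (All.map (λ {a} → ≡.trans (eval-trace-polynomial a)) all≡0) length-trace-polynomial))))
    where
    coefficient-1≡0 : All (_≡ 0#) trace-polynomial → 1# ≡ 0#
    coefficient-1≡0 (_ ∷ 1≡0 ∷ _) = 1≡0

  trace-onto-1 : ∃ λ c → trace c ≡ 1#
  trace-onto-1 with a , t≢0 ← trace-nonzero with t′ , tt′≡1 ← inverse (trace a) t≢0 =
    t′ * a , ≡.trans (trace-*-fixed a t′-fixed) (≡.trans (*-comm t′ t) tt′≡1)
    where
    t = trace a
    t′-fixed : pow t′ p ≡ t′
    t′-fixed = *-cancelˡ t≢0 (begin
      t * pow t′ p          ≡⟨ ≡.cong (_* pow t′ p) (trace-fixed a) ⟨
      pow t p * pow t′ p    ≡⟨ pow-distrib-* t t′ p ⟨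
      pow (t * t′) p        ≡⟨ ≡.cong (λ z → pow z p) tt′≡1 ⟩
      pow 1# p              ≡⟨ pow-1# p ⟩
      1#                    ≡⟨ tt′≡1 ⟨
      t * t′                ∎)

module GroupAlgebra {c ℓ} (F : FiniteField) (p m : ℕ) (R : CommutativeRing c ℓ) (ζ : CommutativeRing.Carrier R) where
  open import Data.Vec using (_++_)
  open Setting F p m R ζ

  -- Laws of the field F; unqualified ring vocabulary below refers to R.
  module 𝔽 where
    open FiniteFieldProperties F public
    open CommutativeRing commutativeRing public
    open RingUtil commutativeRing public using (fromℕ; pow)
    open CommutativeRingProperties commutativeRing public
      using (fromℕ-+; [x-y]+y≈x; [x+y]-y≈x; x-[x-y]≈y; [w-x]+[y-z]≈[w+y]-[x+z]; x*[y*z]≈z)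
    open import Algebra.Properties.AbelianGroup +-abelianGroup public using (identityˡ-unique; ⁻¹-∙-comm; ⁻¹-injective)
    open import Algebra.Properties.Ring ring public using (-‿distribˡ-*; -0#≈0#; x[y-z]≈xy-xz)

  open FiniteField F using (elems; elems-unique; elems-complete)

  take-++ : ∀ {n k} (h : Vecs n) (s : Vecs k) → take n (h ++ s) ≡ h
  take-++ []      s = ≡.refl
  take-++ (x ∷ h) s = ≡.cong (x ∷_) (take-++ h s)

  drop-++ : ∀ {n k} (h : Vecs n) (s : Vecs k) → drop n (h ++ s) ≡ s
  drop-++ []      s = ≡.refl
  drop-++ (x ∷ h) s = drop-++ h s

  zeroV-++ : ∀ n k → zeroV n ++ zeroV k ≡ zeroV (n ℕ.+ k)
  zeroV-++ zero    k = ≡.refl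
  zeroV-++ (suc n) k = ≡.cong (F.0# ∷_) (zeroV-++ n k)

  ++≡zeroV : ∀ {n k} {h : Vecs n} {s : Vecs k} → h ++ s ≡ zeroV (n ℕ.+ k) → h ≡ zeroV n × s ≡ zeroV k
  ++≡zeroV {n} {k} {h} {s} h++s≡0 = Vec.++-injective h (zeroV n) (≡.trans h++s≡0 (≡.sym (zeroV-++ n k)))

  ⟨⟩-zeroʳ : ∀ {k} (v : Vecs k) → ⟨ v , zeroV k ⟩ ≡ F.0#
  ⟨⟩-zeroʳ []      = ≡.refl
  ⟨⟩-zeroʳ (x ∷ v) = ≡.trans (≡.cong₂ F._+_ (𝔽.zeroʳ x) (⟨⟩-zeroʳ v)) (𝔽.+-identityʳ F.0#)

  ⟨⟩-++ : ∀ {n k} (a h : Vecs n) (b s : Vecs k) → ⟨ a ++ b , h ++ s ⟩ ≡ ⟨ a , h ⟩ F.+ ⟨ b , s ⟩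
  ⟨⟩-++ []      []      b s = ≡.sym (𝔽.+-identityˡ _)
  ⟨⟩-++ (x ∷ a) (y ∷ h) b s = ≡.trans (≡.cong (x F.* y F.+_) (⟨⟩-++ a h b s)) (≡.sym (𝔽.+-assoc _ _ _))

  -V-involutive : ∀ {k} (u t : Vecs k) → u -V (u -V t) ≡ t
  -V-involutive []      []      = ≡.refl
  -V-involutive (a ∷ u) (x ∷ t) = ≡.cong₂ _∷_ (𝔽.x-[x-y]≈y a x) (-V-involutive u t)

  ⟨⟩-sub : ∀ {k} (v u t : Vecs k) → ⟨ v , u -V t ⟩ ≡ ⟨ v , u ⟩ 𝔽.- ⟨ v , t ⟩
  ⟨⟩-sub []      []      []      = ≡.sym (𝔽.-‿inverseʳ F.0#)
  ⟨⟩-sub (a ∷ v) (b ∷ u) (e ∷ t) = ≡.trans (≡.cong₂ F._+_ (𝔽.x[y-z]≈xy-xz a b e) (⟨⟩-sub v u t))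
                                           (𝔽.[w-x]+[y-z]≈[w+y]-[x+z] (a F.* b) (a F.* e) _ _)

  length-allVecs : ∀ k → length (allVecs k) ≡ q ℕ.^ k
  length-allVecs zero    = ≡.refl
  length-allVecs (suc k) = length-prefix elems
    where
    length-prefix : ∀ xs → length (concatMap (λ x → map (x ∷_) (allVecs k)) xs) ≡ length xs ℕ.* q ℕ.^ k
    length-prefix []       = ≡.refl
    length-prefix (x ∷ xs) = ≡.trans (List.length-++ (map (x ∷_) (allVecs k)))
      (≡.cong₂ ℕ._+_ (≡.trans (List.length-map (x ∷_) (allVecs k)) (length-allVecs k)) (length-prefix xs))

  module VectorSum {a ℓ′} (M : CommutativeMonoid a ℓ′) where
    open CommutativeMonoid M using (_≈_; _∙_; ε; refl; sym; trans; identityʳ; setoid) renaming (Carrier to C)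
    open FiniteSum M public
    open import Relation.Binary.Reasoning.Setoid setoid

    ΣV : ∀ k → (Vecs k → C) → C
    ΣV k = Σ (allVecs k)

    ΣV-∷ : ∀ k g → ΣV (suc k) g ≈ Σ elems (λ x → ΣV k (g ∘ (x ∷_)))
    ΣV-∷ k g = trans (Σ-concatMap _ elems) (Σ-cong elems (λ x → Σ-map (x ∷_) (allVecs k)))

    ΣV-++ : ∀ n k g → ΣV (n ℕ.+ k) g ≈ ΣV n (λ h → ΣV k (λ s → g (h ++ s)))
    ΣV-++ zero    k g = sym (identityʳ _)
    ΣV-++ (suc n) k g = trans (ΣV-∷ (n ℕ.+ k) g)
      (trans (Σ-cong elems (λ x → ΣV-++ n k (g ∘ (x ∷_)))) (sym (ΣV-∷ n _)))

    ΣV-reflect : ∀ k (u : Vecs k) g → ΣV k (λ t → g (u -V t)) ≈ ΣV k g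
    ΣV-reflect zero    []      g = refl
    ΣV-reflect (suc k) (a ∷ u) g = begin
      ΣV (suc k) (λ t → g ((a ∷ u) -V t))
        ≈⟨ ΣV-∷ k _ ⟩
      Σ elems (λ x → ΣV k (λ t → g ((a 𝔽.- x) ∷ (u -V t))))
        ≈⟨ Σ-cong elems (λ x → ΣV-reflect k u (g ∘ ((a 𝔽.- x) ∷_))) ⟩
      Σ elems (λ x → ΣV k (g ∘ ((a 𝔽.- x) ∷_)))
        ≈⟨ Σ-reindex-complete elems-unique elems-complete (λ x → a 𝔽.- x) (λ x → a 𝔽.- x) a-[a-x]≡x a-[a-x]≡x ⟩
      Σ elems (λ x → ΣV k (g ∘ (x ∷_)))
        ≈⟨ ΣV-∷ k g ⟨
      ΣV (suc k) g                                          ∎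
      where
      a-[a-x]≡x = 𝔽.x-[x-y]≈y a

    ΣV-single : ∀ k g → (∀ t → t ≢ zeroV k → g t ≈ ε) → ΣV k g ≈ g (zeroV k)
    ΣV-single zero    g _   = identityʳ _
    ΣV-single (suc k) g g≈ε = begin
      ΣV (suc k) g                       ≈⟨ ΣV-∷ k g ⟩
      Σ elems (λ x → ΣV k (g ∘ (x ∷_)))  ≈⟨ Σ-single elems-unique (elems-complete F.0#) off-zero ⟩
      ΣV k (g ∘ (F.0# ∷_))               ≈⟨ ΣV-single k (g ∘ (F.0# ∷_)) (λ t t≢0 → g≈ε (F.0# ∷ t) (t≢0 ∘ Vec.∷-injectiveʳ)) ⟩
      g (zeroV (suc k))                  ∎
      where
      off-zero : ∀ {x} → x ∈ elems → x ≢ F.0# → ΣV k (g ∘ (x ∷_)) ≈ ε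
      off-zero {x} _ x≢0 = Σ-ε (allVecs k) (λ {t} _ → g≈ε (x ∷ t) (x≢0 ∘ Vec.∷-injectiveˡ))

  module Counting (n d : ℕ) where
    module ℕΣ = VectorSum ℕ.+-0-commutativeMonoid

    𝟙 : Bool → ℕ
    𝟙 b = if b then 1 else 0

    length-filter : ∀ {A : Set} {P : A → Set} (P? : Decidable P) xs → length (filter P? xs) ≡ ℕΣ.Σ xs (𝟙 ∘ does ∘ P?)
    length-filter P? []       = ≡.refl
    length-filter P? (x ∷ xs) with does (P? x)
    ... | true  = ≡.cong suc (length-filter P? xs)
    ... | false = length-filter P? xs

    ΣV-const : ∀ k c → ℕΣ.ΣV k (λ _ → c) ≡ q ℕ.^ k ℕ.* c
    ΣV-const k c = ≡.trans (Σ-const (allVecs k)) (≡.cong (ℕ._* c) (length-allVecs k))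
      where
      Σ-const : ∀ {A : Set} (xs : List A) → ℕΣ.Σ xs (λ _ → c) ≡ length xs ℕ.* c
      Σ-const []       = ≡.refl
      Σ-const (x ∷ xs) = ≡.cong (c ℕ.+_) (Σ-const xs)

    count-zero : ∀ k → ℕΣ.ΣV k (λ t → 𝟙 (does (t ≟V zeroV k))) ≡ 1
    count-zero k = ≡.trans (ℕΣ.ΣV-single k _ (λ t t≢0 → ≡.cong 𝟙 (dec-false (t ≟V zeroV k) t≢0)))
                           (≡.cong 𝟙 (dec-true (zeroV k ≟V zeroV k) ≡.refl))

    count-nonzero : ∀ k → ℕΣ.ΣV k (λ t → 𝟙 (does (¬? (t ≟V zeroV k)))) ≡ q ℕ.^ k ℕ.∸ 1
    count-nonzero k = ≡.sym (≡.trans (≡.cong (ℕ._∸ 1) total) (ℕ.m+n∸n≡m _ 1))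
      where
      𝟙¬+𝟙≡1 : ∀ {A : Set} (a? : Dec A) → 𝟙 (does (¬? a?)) ℕ.+ 𝟙 (does a?) ≡ 1
      𝟙¬+𝟙≡1 (yes _) = ≡.refl
      𝟙¬+𝟙≡1 (no _)  = ≡.refl
      total : q ℕ.^ k ≡ ℕΣ.ΣV k (λ t → 𝟙 (does (¬? (t ≟V zeroV k)))) ℕ.+ 1
      total = begin
        q ℕ.^ k
          ≡⟨ ℕ.*-identityʳ _ ⟨
        q ℕ.^ k ℕ.* 1
          ≡⟨ ΣV-const k 1 ⟨
        ℕΣ.ΣV k (λ _ → 1)
          ≡⟨ ℕΣ.Σ-cong (allVecs k) (λ t → 𝟙¬+𝟙≡1 (t ≟V zeroV k)) ⟨
        ℕΣ.ΣV k (λ t → 𝟙 (does (¬? (t ≟V zeroV k))) ℕ.+ 𝟙 (does (t ≟V zeroV k)))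
          ≡⟨ ℕΣ.Σ-distrib-∙ (allVecs k) ⟩
        ℕΣ.ΣV k (λ t → 𝟙 (does (¬? (t ≟V zeroV k)))) ℕ.+ ℕΣ.ΣV k (λ t → 𝟙 (does (t ≟V zeroV k)))
          ≡⟨ ≡.cong (ℕΣ.ΣV k (λ t → 𝟙 (does (¬? (t ≟V zeroV k)))) ℕ.+_) (count-zero k) ⟩
        ℕΣ.ΣV k (λ t → 𝟙 (does (¬? (t ≟V zeroV k)))) ℕ.+ 1                      ∎
        where open ≡.≡-Reasoning


    count-split : ∀ {P : Vecs (n ℕ.+ d) → Set} (P? : Decidable P) →
                  count n d P P? ≡ ℕΣ.ΣV n (λ h → ℕΣ.ΣV d (λ s → 𝟙 (does (P? (h ++ s)))))
    count-split P? = ≡.trans (length-filter P? (allVecs (n ℕ.+ d))) (ℕΣ.ΣV-++ n d _)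

    count₁ : count n d _ (class₁? n d) ≡ 1
    count₁ = ≡.trans (length-filter (class₁? n d) (allVecs (n ℕ.+ d))) (count-zero (n ℕ.+ d))

    count₂ : count n d _ (class₂? n d) ≡ q ℕ.^ (n ℕ.+ d) ℕ.∸ q ℕ.^ n
    count₂ = begin
      count n d _ (class₂? n d)
        ≡⟨ count-split (class₂? n d) ⟩
      ℕΣ.ΣV n (λ h → ℕΣ.ΣV d (λ s → 𝟙 (does (class₂? n d (h ++ s)))))
        ≡⟨ ℕΣ.Σ-cong (allVecs n) (λ h → ℕΣ.Σ-cong (allVecs d) (λ s → ≡.cong 𝟙 (tail-++ h s))) ⟩
      ℕΣ.ΣV n (λ h → ℕΣ.ΣV d (λ s → 𝟙 (does (¬? (s ≟V zeroV d)))))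
        ≡⟨ ℕΣ.Σ-cong (allVecs n) (λ _ → count-nonzero d) ⟩
      ℕΣ.ΣV n (λ _ → q ℕ.^ d ℕ.∸ 1)
        ≡⟨ ΣV-const n _ ⟩
      q ℕ.^ n ℕ.* (q ℕ.^ d ℕ.∸ 1)
        ≡⟨ ℕ.*-distribˡ-∸ (q ℕ.^ n) (q ℕ.^ d) 1 ⟩
      q ℕ.^ n ℕ.* q ℕ.^ d ℕ.∸ q ℕ.^ n ℕ.* 1
        ≡⟨ ≡.cong₂ ℕ._∸_ (≡.sym (ℕ.^-distribˡ-+-* q n d)) (ℕ.*-identityʳ (q ℕ.^ n)) ⟩
      q ℕ.^ (n ℕ.+ d) ℕ.∸ q ℕ.^ n
        ∎
      where
      open ≡.≡-Reasoning
      tail-++ : ∀ h s → does (class₂? n d (h ++ s)) ≡ does (¬? (s ≟V zeroV d))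
      tail-++ h s = does-⇔ (≡.subst (λ t → t ≢ zeroV d ⇔ s ≢ zeroV d) (≡.sym (drop-++ h s)) (mk⇔ id id))
                           (class₂? n d (h ++ s)) (¬? (s ≟V zeroV d))

    count₃ : count n d _ (class₃? n d) ≡ q ℕ.^ n ℕ.∸ 1
    count₃ = begin
      count n d _ (class₃? n d)                                           ≡⟨ count-split (class₃? n d) ⟩
      ℕΣ.ΣV n (λ h → ℕΣ.ΣV d (λ s → 𝟙 (does (class₃? n d (h ++ s)))))    ≡⟨ ℕΣ.Σ-cong (allVecs n) row ⟩
      ℕΣ.ΣV n (λ h → 𝟙 (does (¬? (h ≟V zeroV n))))                       ≡⟨ count-nonzero n ⟩
      q ℕ.^ n ℕ.∸ 1                                                       ∎
      where
      open ≡.≡-Reasoning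
      tail-nonzero : ∀ h s → s ≢ zeroV d → does (class₃? n d (h ++ s)) ≡ false
      tail-nonzero h s s≢0 = dec-false (class₃? n d (h ++ s)) (λ (_ , tail≡0) → s≢0 (≡.trans (≡.sym (drop-++ h s)) tail≡0))
      tail-zero : ∀ h → (h ++ zeroV d ≢ zeroV (n ℕ.+ d) × tail n d (h ++ zeroV d) ≡ zeroV d) ⇔ h ≢ zeroV n
      tail-zero h = mk⇔ (λ (h++0≢0 , _) h≡0 → h++0≢0 (≡.trans (≡.cong (_++ zeroV d) h≡0) (zeroV-++ n d)))
                        (λ h≢0 → (h≢0 ∘ proj₁ ∘ ++≡zeroV) , drop-++ h (zeroV d))
      row : ∀ h → ℕΣ.ΣV d (λ s → 𝟙 (does (class₃? n d (h ++ s)))) ≡ 𝟙 (does (¬? (h ≟V zeroV n)))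
      row h = ≡.trans (ℕΣ.ΣV-single d _ (λ s s≢0 → ≡.cong 𝟙 (tail-nonzero h s s≢0)))
                      (≡.cong 𝟙 (does-⇔ (tail-zero h) (class₃? n d (h ++ zeroV d)) (¬? (h ≟V zeroV n))))

  open CommutativeRing R
  open RingUtil R
  open CommutativeRingProperties R
  open import Relation.Binary.Reasoning.Setoid setoid
  open import Algebra.Properties.CommutativeSemigroup *-commutativeSemigroup using (x∙yz≈y∙xz)
  open SemiringSum commutativeSemiring using (Σ; Σ-cong; Σ-swap; Σ-single; Σ-reindex-complete; *-distribˡ-Σ; *-distribʳ-Σ; Σ-product)
  open VectorSum +-commutativeMonoid using (ΣV; ΣV-∷; ΣV-++; ΣV-reflect; ΣV-single)

  natF≡fromℕ : ∀ k → natF k ≡ 𝔽.fromℕ k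
  natF≡fromℕ zero    = ≡.refl
  natF≡fromℕ (suc k) = ≡.cong (F.1# F.+_) (natF≡fromℕ k)

  powF≡pow : ∀ x k → powF x k ≡ 𝔽.pow x k
  powF≡pow x zero    = ≡.refl
  powF≡pow x (suc k) = ≡.cong (x F.*_) (powF≡pow x k)

  natF-+ : ∀ i j → natF (i ℕ.+ j) ≡ natF i F.+ natF j
  natF-+ i j rewrite natF≡fromℕ (i ℕ.+ j) | natF≡fromℕ i | natF≡fromℕ j = 𝔽.fromℕ-+ i j

  module Characters (prime : Prime p) (q≡p^m : q ≡ p ℕ.^ m) (ζ-root : RootOfUnityData p ζ) where
    private instance
      p≢0 : ℕ.NonZero p
      p≢0 = prime⇒nonZero prime
    open PrimePowerField F {p} {m} prime q≡p^m
      using (trace; trace-+; trace-*-fixed; trace∈𝔽p; trace-onto-1; pow-fromℕ-p; fromℕ-%p; fromℕ-injective)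

    Tr≡trace : ∀ x → Tr x ≡ trace x
    Tr≡trace x = SemiringSum.Σ-cong 𝔽.commutativeSemiring (upTo m) (λ i → powF≡pow x (p ℕ.^ i))

    Tr∈𝔽p : ∀ x → ∃ λ k → k < p × Tr x ≡ natF k
    Tr∈𝔽p x with k , k<p , trace≡k ← trace∈𝔽p x = k , k<p , ≡.trans (Tr≡trace x) (≡.trans trace≡k (≡.sym (natF≡fromℕ k)))

    Tr-+ : ∀ x y → Tr (x F.+ y) ≡ Tr x F.+ Tr y
    Tr-+ x y rewrite Tr≡trace (x F.+ y) | Tr≡trace x | Tr≡trace y = trace-+ x y

    Tr-natF-* : ∀ k x → Tr (natF k F.* x) ≡ natF k F.* Tr x
    Tr-natF-* k x rewrite Tr≡trace (natF k F.* x) | Tr≡trace x | natF≡fromℕ k = trace-*-fixed x (pow-fromℕ-p k)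

    Tr-onto : ∀ k → ∃ λ c → Tr c ≡ natF k
    Tr-onto k with c , trace-c≡1 ← trace-onto-1 =
      natF k F.* c , ≡.trans (Tr-natF-* k c) (≡.trans (≡.cong (natF k F.*_) (≡.trans (Tr≡trace c) trace-c≡1)) (𝔽.*-identityʳ _))

    Tr-0 : Tr F.0# ≡ F.0#
    Tr-0 = ≡.trans (≡.cong Tr (≡.sym (𝔽.zeroˡ F.0#))) (≡.trans (Tr-natF-* 0 F.0#) (𝔽.zeroˡ _))

    eF-natF-< : ∀ {k} → k < p → eF (natF k) ≈ pow ζ k
    eF-natF-< {k} k<p = trans (Σ-single (Unique.upTo⁺ p) (∈-upTo⁺ k<p) off-k) on-k
      where
      on-k : (if ⌊ natF k F.≟ natF k ⌋ then pow ζ k else 0#) ≈ pow ζ k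
      on-k with natF k F.≟ natF k
      ... | yes _   = refl
      ... | no  k≢k = ⊥-elim (k≢k ≡.refl)
      off-k : ∀ {j} → j ∈ upTo p → j ≢ k → (if ⌊ natF k F.≟ natF j ⌋ then pow ζ j else 0#) ≈ 0#
      off-k {j} j∈ j≢k with natF k F.≟ natF j
      ... | no  _    = refl
      ... | yes k≡j  = ⊥-elim (j≢k (≡.sym (fromℕ-injective (F.0≢1 ∘ ≡.sym) k<p (∈-upTo⁻ j∈)
                         (≡.trans (≡.sym (natF≡fromℕ k)) (≡.trans k≡j (natF≡fromℕ j))))))

    eF-natF : ∀ k → eF (natF k) ≈ pow ζ k
    eF-natF k = begin
      eF (natF k)          ≡⟨ ≡.cong eF natF-k≡natF-k%p ⟩
      eF (natF (k % p))    ≈⟨ eF-natF-< (m%n<n k p) ⟩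
      pow ζ (k % p)        ≈⟨ pow-% (proj₁ ζ-root) k ⟨
      pow ζ k              ∎
      where
      natF-k≡natF-k%p : natF k ≡ natF (k % p)
      natF-k≡natF-k%p = ≡.trans (natF≡fromℕ k) (≡.trans (fromℕ-%p k) (≡.sym (natF≡fromℕ (k % p))))

    ψ : F.Carrier → Carrier
    ψ x = eF (Tr x)

    ψ-natF : ∀ {x} k → Tr x ≡ natF k → ψ x ≈ pow ζ k
    ψ-natF k Tx≡k = trans (reflexive (≡.cong eF Tx≡k)) (eF-natF k)

    ψ-0 : ψ F.0# ≈ 1#
    ψ-0 = ψ-natF 0 Tr-0

    ψ[-0]≈1 : ψ (F.- F.0#) ≈ 1#
    ψ[-0]≈1 = trans (reflexive (≡.cong ψ 𝔽.-0#≈0#)) ψ-0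

    ψ[-⟨v,0⟩]≈1 : ∀ {k} (v : Vecs k) → ψ (F.- ⟨ v , zeroV k ⟩) ≈ 1#
    ψ[-⟨v,0⟩]≈1 v = trans (reflexive (≡.cong (ψ ∘ F.-_) (⟨⟩-zeroʳ v))) ψ[-0]≈1

    ψ-+ : ∀ x y → ψ (x F.+ y) ≈ ψ x * ψ y
    ψ-+ x y with i , _ , Tx≡i ← Tr∈𝔽p x | j , _ , Ty≡j ← Tr∈𝔽p y = begin
      ψ (x F.+ y)
        ≈⟨ ψ-natF (i ℕ.+ j) (≡.trans (Tr-+ x y) (≡.trans (≡.cong₂ F._+_ Tx≡i Ty≡j) (≡.sym (natF-+ i j)))) ⟩
      pow ζ (i ℕ.+ j)
        ≈⟨ pow-+ ζ i j ⟩
      pow ζ i * pow ζ j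
        ≈⟨ *-cong (ψ-natF i Tx≡i) (ψ-natF j Ty≡j) ⟨
      ψ x * ψ y            ∎

    -- Translating by c with Tr c = k shows that every fibre of Tr has N elements,
    -- so Σ ψ = N · Σ_{k<p} ζ^k = 0 (R need not be a domain, so ψ(c) · Σ ψ = Σ ψ would not suffice).
    Σψ≈0 : Σ elems ψ ≈ 0#
    Σψ≈0 = begin
      Σ elems (λ x → Σ (upTo p) (term x))     ≈⟨ Σ-swap elems (upTo p) term ⟩
      Σ (upTo p) (λ k → Σ elems (λ x → term x k)) ≈⟨ Σ-cong (upTo p) fibre ⟩
      Σ (upTo p) (λ k → N * pow ζ k)          ≈⟨ *-distribˡ-Σ N (upTo p) (pow ζ) ⟨
      N * Σ (upTo p) (pow ζ)                  ≈⟨ *-congˡ (proj₂ ζ-root) ⟩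
      N * 0#                                  ≈⟨ zeroʳ N ⟩
      0#                                      ∎
      where
      term : F.Carrier → ℕ → Carrier
      term x k = if ⌊ Tr x F.≟ natF k ⌋ then pow ζ k else 0#
      N : Carrier
      N = Σ elems (λ x → if ⌊ Tr x F.≟ F.0# ⌋ then 1# else 0#)
      fibre : ∀ k → Σ elems (λ x → term x k) ≈ N * pow ζ k
      fibre k with c , Tc≡k ← Tr-onto k = begin
        Σ elems (λ x → term x k)
          ≈⟨ Σ-reindex-complete elems-unique elems-complete (F._+ c) (𝔽._- c) (λ x → 𝔽.[x-y]+y≈x x c) (λ x → 𝔽.[x+y]-y≈x x c) ⟨
        Σ elems (λ x → term (x F.+ c) k)
          ≈⟨ Σ-cong elems (λ x → reflexive (≡.cong (λ b → if b then pow ζ k else 0#) (shifted-test x))) ⟩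
        Σ elems (λ x → if ⌊ Tr x F.≟ F.0# ⌋ then pow ζ k else 0#)
          ≈⟨ Σ-cong elems (λ x → if-then-0 _ (pow ζ k)) ⟩
        Σ elems (λ x → (if ⌊ Tr x F.≟ F.0# ⌋ then 1# else 0#) * pow ζ k)
          ≈⟨ *-distribʳ-Σ (pow ζ k) elems _ ⟨
        N * pow ζ k                            ∎
        where
        Tr-x+c : ∀ x → Tr (x F.+ c) ≡ Tr x F.+ natF k
        Tr-x+c x = ≡.trans (Tr-+ x c) (≡.cong (Tr x F.+_) Tc≡k)
        Tr-shift : ∀ x → Tr (x F.+ c) ≡ natF k ⇔ Tr x ≡ F.0#
        Tr-shift x = mk⇔ (λ e → 𝔽.identityˡ-unique (Tr x) (natF k) (≡.trans (≡.sym (Tr-x+c x)) e))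
                         (λ e → ≡.trans (Tr-x+c x) (≡.trans (≡.cong (F._+ natF k) e) (𝔽.+-identityˡ _)))
        shifted-test : ∀ x → ⌊ Tr (x F.+ c) F.≟ natF k ⌋ ≡ ⌊ Tr x F.≟ F.0# ⌋
        shifted-test x = ⌊⌋-⇔ (Tr-shift x) (Tr (x F.+ c) F.≟ natF k) (Tr x F.≟ F.0#)
        if-then-0 : ∀ b z → (if b then z else 0#) ≈ (if b then 1# else 0#) * z
        if-then-0 true  z = sym (*-identityˡ z)
        if-then-0 false z = sym (zeroˡ z)

    Σψ-*≈0 : ∀ {a} → a ≢ F.0# → Σ elems (λ x → ψ (a F.* x)) ≈ 0#
    Σψ-*≈0 {a} a≢0 with a′ , aa′≡1 ← F.inverse a a≢0 =
      trans (Σ-reindex-complete elems-unique elems-complete (a F.*_) (a′ F.*_)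
                                (𝔽.x*[y*z]≈z aa′≡1) (𝔽.x*[y*z]≈z (≡.trans (𝔽.*-comm a′ a) aa′≡1)))
            Σψ≈0

    characterSum : ∀ k → Vecs k → Carrier
    characterSum k w = ΣV k (λ t → ψ (F.- ⟨ w , t ⟩))

    characterSum-∷ : ∀ k a w → characterSum (suc k) (a ∷ w) ≈ Σ elems (λ x → ψ ((F.- a) F.* x)) * characterSum k w
    characterSum-∷ k a w = begin
      characterSum (suc k) (a ∷ w)
        ≈⟨ ΣV-∷ k _ ⟩
      Σ elems (λ x → ΣV k (λ t → ψ (F.- (a F.* x F.+ ⟨ w , t ⟩))))
        ≈⟨ Σ-cong elems (λ x → Σ-cong (allVecs k) (λ t → split x ⟨ w , t ⟩)) ⟩
      Σ elems (λ x → ΣV k (λ t → ψ ((F.- a) F.* x) * ψ (F.- ⟨ w , t ⟩)))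
        ≈⟨ Σ-product elems (allVecs k) _ _ ⟩
      Σ elems (λ x → ψ ((F.- a) F.* x)) * characterSum k w                   ∎
      where
      split : ∀ x y → ψ (F.- (a F.* x F.+ y)) ≈ ψ ((F.- a) F.* x) * ψ (F.- y)
      split x y = trans (reflexive (≡.cong ψ -[ax+y]≡[-a]x-y)) (ψ-+ _ _)
        where
        -[ax+y]≡[-a]x-y : F.- (a F.* x F.+ y) ≡ (F.- a) F.* x F.+ F.- y
        -[ax+y]≡[-a]x-y = ≡.trans (≡.sym (𝔽.⁻¹-∙-comm (a F.* x) y)) (≡.cong (F._+ F.- y) (𝔽.-‿distribˡ-* a x))

    characterSum-zero : ∀ k → characterSum k (zeroV k) ≈ fromℕ (q ℕ.^ k)
    characterSum-zero zero    = +-congʳ ψ[-0]≈1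
    characterSum-zero (suc k) = begin
      characterSum (suc k) (zeroV (suc k))
        ≈⟨ characterSum-∷ k F.0# (zeroV k) ⟩
      Σ elems (λ x → ψ ((F.- F.0#) F.* x)) * characterSum k (zeroV k)
        ≈⟨ *-cong (Σ-cong elems ψ[-0*x]≈1) (characterSum-zero k) ⟩
      Σ elems (λ _ → 1#) * fromℕ (q ℕ.^ k)
        ≡⟨ ≡.cong (_* fromℕ (q ℕ.^ k)) (ΣL-1# elems) ⟩
      fromℕ q * fromℕ (q ℕ.^ k)
        ≈⟨ fromℕ-* q (q ℕ.^ k) ⟨
      fromℕ (q ℕ.^ suc k)                                               ∎
      where
      ψ[-0*x]≈1 : ∀ x → ψ ((F.- F.0#) F.* x) ≈ 1#
      ψ[-0*x]≈1 x = trans (reflexive (≡.cong ψ (≡.trans (≡.cong (F._* x) 𝔽.-0#≈0#) (𝔽.zeroˡ x)))) ψ-0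

    characterSum-nonzero : ∀ k w → w ≢ zeroV k → characterSum k w ≈ 0#
    characterSum-nonzero zero    []      []≢[] = ⊥-elim ([]≢[] ≡.refl)
    characterSum-nonzero (suc k) (a ∷ w) a∷w≢0 with a F.≟ F.0#
    ... | yes ≡.refl = trans (characterSum-∷ k F.0# w)
                             (trans (*-congˡ (characterSum-nonzero k w (a∷w≢0 ∘ ≡.cong (F.0# ∷_)))) (zeroʳ _))
    ... | no  a≢0    = trans (characterSum-∷ k a w) (trans (*-congʳ (Σψ-*≈0 -a≢0)) (zeroˡ _))
      where
      -a≢0 : F.- a ≢ F.0#
      -a≢0 -a≡0 = a≢0 (𝔽.⁻¹-injective (≡.trans -a≡0 (≡.sym 𝔽.-0#≈0#)))

    χ-nonzero : ¬ (1# ≈ 0#) → ∀ {k} (v : Vecs k) → ¬ (∀ u → χ v u ≈ 0#)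
    χ-nonzero 1≉0 v χ≈0 = 1≉0 (trans (sym (trans (reflexive (≡.cong ψ (⟨⟩-zeroʳ v))) ψ-0)) (χ≈0 (zeroV _)))

    fourier : ∀ {k} → GA k → Vecs k → Carrier
    fourier {k} a v = ΣV k (λ t → a t * ψ (F.- ⟨ v , t ⟩))

    ·GA-χ : ∀ {k} (a : GA k) v u → (a ·GA χ v) u ≈ fourier a v * χ v u
    ·GA-χ {k} a v u = begin
      ΣV k (λ w → a (u -V w) * ψ ⟨ v , w ⟩)                     ≈⟨ ΣV-reflect k u (λ w → a (u -V w) * ψ ⟨ v , w ⟩) ⟨
      ΣV k (λ t → a (u -V (u -V t)) * ψ ⟨ v , u -V t ⟩)         ≈⟨ Σ-cong (allVecs k) term ⟩
      ΣV k (λ t → ψ ⟨ v , u ⟩ * (a t * ψ (F.- ⟨ v , t ⟩)))      ≈⟨ *-distribˡ-Σ (ψ ⟨ v , u ⟩) (allVecs k) _ ⟨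
      ψ ⟨ v , u ⟩ * fourier a v                                 ≈⟨ *-comm _ _ ⟩
      fourier a v * χ v u                                       ∎
      where
      term : ∀ t → a (u -V (u -V t)) * ψ ⟨ v , u -V t ⟩ ≈ ψ ⟨ v , u ⟩ * (a t * ψ (F.- ⟨ v , t ⟩))
      term t = begin
        a (u -V (u -V t)) * ψ ⟨ v , u -V t ⟩              ≡⟨ ≡.cong₂ (λ w x → a w * ψ x) (-V-involutive u t) (⟨⟩-sub v u t) ⟩
        a t * ψ (⟨ v , u ⟩ 𝔽.- ⟨ v , t ⟩)                 ≈⟨ *-congˡ (ψ-+ _ _) ⟩
        a t * (ψ ⟨ v , u ⟩ * ψ (F.- ⟨ v , t ⟩))           ≈⟨ x∙yz≈y∙xz _ _ _ ⟩
        ψ ⟨ v , u ⟩ * (a t * ψ (F.- ⟨ v , t ⟩))           ∎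

    eigenvector : ¬ (1# ≈ 0#) → ∀ n d v k → fourier (f n d) v ≈ fromℕ k → IsEigenvector n d (χ v) k
    eigenvector 1≉0 n d v k f̂≈k = χ-nonzero 1≉0 v , λ u → trans (·GA-χ (f n d) v u) (*-congʳ f̂≈k)

    module Eigenvectors (n d : ℕ) where
      private
        A B : Carrier
        A = fromℕ (q ℕ.^ (d ℕ.* n))
        B = fromℕ (q ℕ.^ (d ℕ.* (n ℕ.∸ 1)))

      f-zero : f n d (zeroV (n ℕ.+ d)) ≡ A
      f-zero with zeroV (n ℕ.+ d) ≟V zeroV (n ℕ.+ d) | head n d (zeroV (n ℕ.+ d)) ≟V zeroV n
      ... | yes _  | _ = ≡.refl
      ... | no 0≢0 | _ = ⊥-elim (0≢0 ≡.refl)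

      f-head-zero : ∀ t → t ≢ zeroV (n ℕ.+ d) → head n d t ≡ zeroV n → f n d t ≡ 0#
      f-head-zero t t≢0 head≡0 with t ≟V zeroV (n ℕ.+ d) | head n d t ≟V zeroV n
      ... | yes t≡0 | _         = ⊥-elim (t≢0 t≡0)
      ... | no _    | yes _     = ≡.refl
      ... | no _    | no head≢0 = ⊥-elim (head≢0 head≡0)

      f-head-nonzero : ∀ t → head n d t ≢ zeroV n → f n d t ≡ B
      f-head-nonzero t head≢0 with t ≟V zeroV (n ℕ.+ d) | head n d t ≟V zeroV n
      ... | yes ≡.refl | _         = ⊥-elim (head≢0 (≡.trans (≡.cong (head n d) (≡.sym (zeroV-++ n d))) (take-++ (zeroV n) (zeroV d))))
      ... | no _       | yes head≡0 = ⊥-elim (head≢0 head≡0)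
      ... | no _       | no _       = ≡.refl

      row : Vecs d → Vecs n → Carrier
      row vs h = ΣV d (λ s → f n d (h ++ s) * ψ (F.- ⟨ vs , s ⟩))

      fourier-f-++ : ∀ vh vs → fourier (f n d) (vh ++ vs) ≈ ΣV n (λ h → ψ (F.- ⟨ vh , h ⟩) * row vs h)
      fourier-f-++ vh vs = trans (ΣV-++ n d _)
        (Σ-cong (allVecs n) (λ h → trans (Σ-cong (allVecs d) (term h)) (sym (*-distribˡ-Σ _ (allVecs d) _))))
        where
        term : ∀ h s → f n d (h ++ s) * ψ (F.- ⟨ vh ++ vs , h ++ s ⟩)
                       ≈ ψ (F.- ⟨ vh , h ⟩) * (f n d (h ++ s) * ψ (F.- ⟨ vs , s ⟩))
        term h s = begin
          f n d (h ++ s) * ψ (F.- ⟨ vh ++ vs , h ++ s ⟩)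
            ≡⟨ ≡.cong (λ x → f n d (h ++ s) * ψ x) (≡.trans (≡.cong F.-_ (⟨⟩-++ vh h vs s)) (≡.sym (𝔽.⁻¹-∙-comm _ _))) ⟩
          f n d (h ++ s) * ψ (F.- ⟨ vh , h ⟩ F.+ F.- ⟨ vs , s ⟩)
            ≈⟨ *-congˡ (ψ-+ _ _) ⟩
          f n d (h ++ s) * (ψ (F.- ⟨ vh , h ⟩) * ψ (F.- ⟨ vs , s ⟩))
            ≈⟨ x∙yz≈y∙xz _ _ _ ⟩
          ψ (F.- ⟨ vh , h ⟩) * (f n d (h ++ s) * ψ (F.- ⟨ vs , s ⟩))     ∎

      row-zero : ∀ vs → row vs (zeroV n) ≈ A
      row-zero vs = begin
        row vs (zeroV n)
          ≈⟨ ΣV-single d _ off-zero ⟩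
        f n d (zeroV n ++ zeroV d) * ψ (F.- ⟨ vs , zeroV d ⟩)
          ≡⟨ ≡.cong₂ (λ t x → f n d t * ψ (F.- x)) (zeroV-++ n d) (⟨⟩-zeroʳ vs) ⟩
        f n d (zeroV (n ℕ.+ d)) * ψ (F.- F.0#)
          ≡⟨ ≡.cong (_* ψ (F.- F.0#)) f-zero ⟩
        A * ψ (F.- F.0#)
          ≈⟨ *-congˡ ψ[-0]≈1 ⟩
        A * 1#
          ≈⟨ *-identityʳ A ⟩
        A                                                       ∎
        where
        off-zero : ∀ s → s ≢ zeroV d → f n d (zeroV n ++ s) * ψ (F.- ⟨ vs , s ⟩) ≈ 0#
        off-zero s s≢0 = trans (*-congʳ (reflexive (f-head-zero (zeroV n ++ s) (s≢0 ∘ proj₂ ∘ ++≡zeroV) (take-++ (zeroV n) s))))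
                               (zeroˡ _)

      row-nonzero : ∀ vs h → h ≢ zeroV n → row vs h ≈ B * characterSum d vs
      row-nonzero vs h h≢0 =
        trans (Σ-cong (allVecs d) (λ s → *-congʳ (reflexive (f-head-nonzero (h ++ s) (h≢0 ∘ ≡.trans (≡.sym (take-++ h s)))))))
                                   (sym (*-distribˡ-Σ B (allVecs d) _))

      row-tail-zero : ∀ h → row (zeroV d) h ≈ A
      row-tail-zero h with h ≟V zeroV n
      ... | yes ≡.refl = row-zero (zeroV d)
      ... | no  h≢0    = begin
        row (zeroV d) h                           ≈⟨ row-nonzero (zeroV d) h h≢0 ⟩
        B * characterSum d (zeroV d)              ≈⟨ *-congˡ (characterSum-zero d) ⟩
        B * fromℕ (q ℕ.^ d)                       ≈⟨ fromℕ-* (q ℕ.^ (d ℕ.* (n ℕ.∸ 1))) (q ℕ.^ d) ⟨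
        fromℕ (q ℕ.^ (d ℕ.* (n ℕ.∸ 1)) ℕ.* q ℕ.^ d)  ≡⟨ ≡.cong fromℕ (q^[d*[n∸1]]*q^d≡q^[d*n] (nonempty h h≢0)) ⟩
        A                                         ∎
        where
        nonempty : ∀ {k} (h : Vecs k) → h ≢ zeroV k → 1 ≤ k
        nonempty []      []≢[] = ⊥-elim ([]≢[] ≡.refl)
        nonempty (_ ∷ _) _     = s≤s z≤n
        q^[d*[n∸1]]*q^d≡q^[d*n] : 1 ≤ n → q ℕ.^ (d ℕ.* (n ℕ.∸ 1)) ℕ.* q ℕ.^ d ≡ q ℕ.^ (d ℕ.* n)
        q^[d*[n∸1]]*q^d≡q^[d*n] (s≤s {n = n′} _) = ≡.trans (≡.sym (ℕ.^-distribˡ-+-* q (d ℕ.* n′) d))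
          (≡.cong (q ℕ.^_) (≡.trans (ℕ.+-comm (d ℕ.* n′) d) (≡.sym (ℕ.*-suc d n′))))

      fourier-tail-zero : ∀ vh → fourier (f n d) (vh ++ zeroV d) ≈ characterSum n vh * A
      fourier-tail-zero vh = begin
        fourier (f n d) (vh ++ zeroV d)                        ≈⟨ fourier-f-++ vh (zeroV d) ⟩
        ΣV n (λ h → ψ (F.- ⟨ vh , h ⟩) * row (zeroV d) h)      ≈⟨ Σ-cong (allVecs n) (λ h → *-congˡ (row-tail-zero h)) ⟩
        ΣV n (λ h → ψ (F.- ⟨ vh , h ⟩) * A)                    ≈⟨ *-distribʳ-Σ A (allVecs n) _ ⟨
        characterSum n vh * A                                  ∎

      fourier-tail-nonzero : ∀ vh vs → vs ≢ zeroV d → fourier (f n d) (vh ++ vs) ≈ A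
      fourier-tail-nonzero vh vs vs≢0 = begin
        fourier (f n d) (vh ++ vs)                              ≈⟨ fourier-f-++ vh vs ⟩
        ΣV n (λ h → ψ (F.- ⟨ vh , h ⟩) * row vs h)              ≈⟨ ΣV-single n _ off-zero ⟩
        ψ (F.- ⟨ vh , zeroV n ⟩) * row vs (zeroV n)             ≈⟨ *-cong (ψ[-⟨v,0⟩]≈1 vh) (row-zero vs) ⟩
        1# * A                                                  ≈⟨ *-identityˡ A ⟩
        A                                                       ∎
        where
        off-zero : ∀ h → h ≢ zeroV n → ψ (F.- ⟨ vh , h ⟩) * row vs h ≈ 0#
        off-zero h h≢0 = trans (*-congˡ (trans (row-nonzero vs h h≢0) (trans (*-congˡ (characterSum-nonzero d vs vs≢0)) (zeroʳ B))))
                               (zeroʳ _)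

      head++tail : ∀ v → head n d v ++ tail n d v ≡ v
      head++tail = Vec.take++drop≡id n

      fourier-f-zero : fourier (f n d) (zeroV (n ℕ.+ d)) ≈ fromℕ (q ℕ.^ ((d ℕ.+ 1) ℕ.* n))
      fourier-f-zero = begin
        fourier (f n d) (zeroV (n ℕ.+ d))
          ≡⟨ ≡.cong (fourier (f n d)) (zeroV-++ n d) ⟨
        fourier (f n d) (zeroV n ++ zeroV d)
          ≈⟨ fourier-tail-zero (zeroV n) ⟩
        characterSum n (zeroV n) * A
          ≈⟨ *-congʳ (characterSum-zero n) ⟩
        fromℕ (q ℕ.^ n) * A
          ≈⟨ fromℕ-* (q ℕ.^ n) _ ⟨
        fromℕ (q ℕ.^ n ℕ.* q ℕ.^ (d ℕ.* n))
          ≡⟨ ≡.cong fromℕ (≡.trans (≡.sym (ℕ.^-distribˡ-+-* q n (d ℕ.* n))) (≡.cong (λ e → q ℕ.^ (e ℕ.* n)) (ℕ.+-comm 1 d))) ⟩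
        fromℕ (q ℕ.^ ((d ℕ.+ 1) ℕ.* n))            ∎

      fourier-f-tail-nonzero : ∀ v → tail n d v ≢ zeroV d → fourier (f n d) v ≈ A
      fourier-f-tail-nonzero v tail≢0 =
        trans (reflexive (≡.cong (fourier (f n d)) (≡.sym (head++tail v)))) (fourier-tail-nonzero (head n d v) (tail n d v) tail≢0)

      fourier-f-head-only : ∀ v → v ≢ zeroV (n ℕ.+ d) → tail n d v ≡ zeroV d → fourier (f n d) v ≈ 0#
      fourier-f-head-only v v≢0 tail≡0 = begin
        fourier (f n d) v                                   ≡⟨ ≡.cong (fourier (f n d)) v≡head++0 ⟩
        fourier (f n d) (head n d v ++ zeroV d)             ≈⟨ fourier-tail-zero (head n d v) ⟩
        characterSum n (head n d v) * A                     ≈⟨ *-congʳ (characterSum-nonzero n (head n d v) head≢0) ⟩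
        0# * A                                              ≈⟨ zeroˡ A ⟩
        0#                                                  ∎
        where
        v≡head++0 : v ≡ head n d v ++ zeroV d
        v≡head++0 = ≡.trans (≡.sym (head++tail v)) (≡.cong (head n d v ++_) tail≡0)
        head≢0 : head n d v ≢ zeroV n
        head≢0 head≡0 = v≢0 (≡.trans v≡head++0 (≡.trans (≡.cong (_++ zeroV d) head≡0) (zeroV-++ n d)))

      χ-zero-eigenvector : ¬ (1# ≈ 0#) → IsEigenvector n d (χ (zeroV (n ℕ.+ d))) (q ℕ.^ ((d ℕ.+ 1) ℕ.* n))
      χ-zero-eigenvector 1≉0 = eigenvector 1≉0 n d (zeroV (n ℕ.+ d)) (q ℕ.^ ((d ℕ.+ 1) ℕ.* n)) fourier-f-zero

      χ-tail-nonzero-eigenvector : ¬ (1# ≈ 0#) → ∀ v → tail n d v ≢ zeroV d → IsEigenvector n d (χ v) (q ℕ.^ (d ℕ.* n))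
      χ-tail-nonzero-eigenvector 1≉0 v tail≢0 = eigenvector 1≉0 n d v (q ℕ.^ (d ℕ.* n)) (fourier-f-tail-nonzero v tail≢0)

      χ-head-only-eigenvector : ¬ (1# ≈ 0#) → ∀ v → v ≢ zeroV (n ℕ.+ d) → tail n d v ≡ zeroV d → IsEigenvector n d (χ v) 0
      χ-head-only-eigenvector 1≉0 v v≢0 tail≡0 = eigenvector 1≉0 n d v 0 (fourier-f-head-only v v≢0 tail≡0)

open import Data.Nat using (_+_; _*_; _^_; _∸_)

theorem3p4 : ∀ {c ℓ} (F : FiniteField) (p m : ℕ) → Prime p → FiniteField.size F ≡ p ^ m →
    (R : CommutativeRing c ℓ) (ζ : CommutativeRing.Carrier R) →
    RingUtil.RootOfUnityData R p ζ →
    ¬ (CommutativeRing._≈_ R (CommutativeRing.1# R) (CommutativeRing.0# R)) →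
    (n d : ℕ) →
    let open Setting F p m R ζ in
    (∀ v → v ≡ zeroV (n + d) → IsEigenvector n d (χ v) (q ^ ((d + 1) * n)))
    × (∀ v → tail n d v ≢ zeroV d → IsEigenvector n d (χ v) (q ^ (d * n)))
    × (∀ v → v ≢ zeroV (n + d) → tail n d v ≡ zeroV d → IsEigenvector n d (χ v) 0)
    × (count n d _ (class₁? n d) ≡ 1)
    × (count n d _ (class₂? n d) ≡ q ^ (n + d) ∸ q ^ n)
    × (count n d _ (class₃? n d) ≡ q ^ n ∸ 1)
theorem3p4 F p m p-prime q≡p^m R ζ ζ-root 1≉0 n d =
    (λ { _ ≡.refl → χ-zero-eigenvector 1≉0 })
  , χ-tail-nonzero-eigenvector 1≉0
  , χ-head-only-eigenvector 1≉0
  , count₁ , count₂ , count₃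
  where
  open GroupAlgebra F p m R ζ
  open Characters p-prime q≡p^m ζ-root
  open Eigenvectors n d
  open Counting n d
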